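{- Let $n,k$ be positive integers with $n\ge2(k+1)$, let $G=W_n^k$ and let $C\subseteq V(G)$ (possibly empty). Then $\gamma_{\rm gr}(G;C)=m_1$ in the following cases: (i) $C=V(G)$, or (ii) there is $i\in V(G)\setminus C$ such that $V(G)\setminus N[i]$ induces a path $P_t$ with $t=n-2k-1$ and $C$ is a good configuration for this path. Otherwise $\gamma_{\rm gr}(G;C)=m_1-1$.
   Context: The web $W_n^k$ has vertex set $V=\{0,\ldots,n-1\}$ and edge set $\{(i,j): 0<|i-j|\le k \text{ or } |i-j|\ge n-k\}$. For $v\in V$, $N(v)$ is the open neighborhood, $N[v]=N(v)\cup\{v\}$, and $N\langle v\rangle=N[v]$ if $v\in C$, $N\langle v\rangle=N(v)$ otherwise. A sequence $(v_1,\ldots,v_k)$ of distinct vertices is legal if $N\langle v_i\rangle\setminus\bigcup_{j<i}N\langle v_j\rangle\ne\emptyset$ for $i=2,\ldots,k$, and dominating if $\bigcup_j N\langle v_j\rangle=V$; $\gamma_{\rm gr}(G;C)$ is the maximum length of a legal dominating sequence. $m_1=n-\delta_1+1$ with $\delta_1=\min_v|N\langle v\rangle|$; for webs, $m_1=n-2k$ if $C=V$ and $m_1=n-2k+1$ if $C\ne V$. Good configuration (gconf): for a path $Q$ whose vertices in path order are $u_1,\ldots,u_s$, a set $C$ is a gconf for $Q$ (meaning $C\cap V(Q)$ is considered; isolated vertices outside $C$ allowed) if (i) $s=1$ and $u_1\in C$; or (ii) $s=2$ and $\{u_1,u_2\}\not\subseteq C$; or (iii) $s\ge3$ and either $u_1\notin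 C$ and $C$ is a gconf for the subpath $u_3,\ldots,u_s$, or $u_s\notin C$ and $C$ is a gconf for the subpath $u_1,\ldots,u_{s-2}$. -}

module Defs where

open import Data.Nat using (ℕ; zero; suc; _+_; _*_; _∸_; _≤_; _⊓_; _≤ᵇ_; ∣_-_∣)
open import Data.Bool using (Bool; true; false; not; _∧_; _∨_; if_then_else_)
open import Data.Fin using (Fin; toℕ; _≟_)
open import Data.Fin.Subset using (Subset; inside; outside; _∈_; _∉_; _∪_; ∣_∣)
open import Data.Vec using (tabulate)
import Data.Fin.Subset
import Data.Fin.Subset.Properties
open import Data.List using (List; []; _∷_; [_]; _++_; length; map; foldr; lookup; allFin)
open import Data.List.Relation.Unary.Unique.Propositional using (Unique)
import Data.List.Membership.Propositional as LM
open import Data.Product using (Σ; ∃; ∃-syntax; _×_)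
open import Data.Unit using (⊤)
open import Relation.Nullary using (¬_; does)
open import Relation.Binary.PropositionalEquality using (_≡_)
open import Function.Bundles using (_⇔_)

adj : (n k : ℕ) → Fin n → Fin n → Bool
adj n k i j = not (does (i ≟ j)) ∧
  ((∣ toℕ i - toℕ j ∣ ≤ᵇ k) ∨ ((n ∸ k) ≤ᵇ ∣ toℕ i - toℕ j ∣))

toSide : Bool → Data.Fin.Subset.Side
toSide b = if b then inside else outside

Nclosed : (n k : ℕ) → Fin n → Subset n
Nclosed n k v = tabulate (λ w → toSide (does (w ≟ v) ∨ adj n k v w))

Nang : (n k : ℕ) → Subset n → Fin n → Subset n
Nang n k C v = tabulate (λ w → toSide ((does (w ≟ v) ∧ does (Data.Fin.Subset.Properties._∈?_ v C)) ∨ adj n k v w))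

-- Legality relative to the union `acc` of the neighbourhoods of the earlier vertices
LegalFrom : (n k : ℕ) → Subset n → Subset n → List (Fin n) → Set
LegalFrom n k C acc [] = ⊤
LegalFrom n k C acc (v ∷ vs) =
  (∃[ w ] (w ∈ Nang n k C v × w ∉ acc)) × LegalFrom n k C (acc ∪ Nang n k C v) vs

Legal : (n k : ℕ) → Subset n → List (Fin n) → Set
Legal n k C [] = ⊤
Legal n k C (v ∷ vs) = Unique (v ∷ vs) × LegalFrom n k C (Nang n k C v) vs

Dominating : (n k : ℕ) → Subset n → List (Fin n) → Set
Dominating n k C vs = ∀ w → w ∈ Data.Fin.Subset.⋃ (map (Nang n k C) vs)

IsGammaGr : (n k : ℕ) → Subset n → ℕ → Set
IsGammaGr n k C m =
  (∃[ vs ] (Legal n k C vs × Dominating n k C vs × length vs ≡ m)) ×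
  (∀ vs → Legal n k C vs → Dominating n k C vs → length vs ≤ m)

-- δ₁ = min_v |N⟨v⟩|  (n is an upper bound, used as the fold's unit), m₁ = n - δ₁ + 1
δ₁ : (n k : ℕ) → Subset n → ℕ
δ₁ n k C = foldr _⊓_ n (map (λ v → ∣ Nang n k C v ∣) (allFin n))

m₁ : (n k : ℕ) → Subset n → ℕ
m₁ n k C = n ∸ δ₁ n k C + 1

-- good configuration for a path given by its vertices in path order
data Gconf {n : ℕ} (C : Subset n) : List (Fin n) → Set where
  gc-one   : ∀ {u} → u ∈ C → Gconf C [ u ]
  gc-two   : ∀ {u₁ u₂} → ¬ (u₁ ∈ C × u₂ ∈ C) → Gconf C (u₁ ∷ u₂ ∷ [])
  gc-left  : ∀ {u₁ u₂ u₃ rest} → u₁ ∉ C → Gconf C (u₃ ∷ rest) → Gconf C (u₁ ∷ u₂ ∷ u₃ ∷ rest)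
  gc-right : ∀ {u₁ init uₛ₋₁ uₛ} → uₛ ∉ C → Gconf C (u₁ ∷ init) →
             Gconf C ((u₁ ∷ init) ++ (uₛ₋₁ ∷ uₛ ∷ []))

InducedPathAvoiding : (n k : ℕ) → Fin n → List (Fin n) → Set
InducedPathAvoiding n k i us =
  Unique us ×
  (∀ w → (w LM.∈ us) ⇔ (w ∉ Nclosed n k i)) ×
  (∀ a b → (adj n k (lookup us a) (lookup us b) ≡ true) ⇔ (∣ toℕ a - toℕ b ∣ ≡ 1))

CaseI : (n : ℕ) → Subset n → Set
CaseI n C = ∀ v → v ∈ C

CaseII : (n k : ℕ) → Subset n → Set
CaseII n k C = ∃[ i ] (i ∉ C × ∃[ us ]
  (length us ≡ n ∸ (2 * k + 1) × InducedPathAvoiding n k i us × Gconf C us))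

module Submission where

-- Write n = 2k + 1 + t.  After the first vertex v every step footprints a new vertex, so a legal
-- sequence has length at most n − |N⟨v⟩| + 1 ≤ m₁, while the consecutive vertices 0, 1, …, t form a
-- legal dominating sequence of length t + 1.  This settles C = V, where m₁ = t + 1.
-- Otherwise m₁ = t + 2, and a sequence of that length starts at some i ∉ C and then footprints exactly
-- one new vertex per step.  Besides i itself, the vertices still to be footprinted form the far side
-- V ∖ N[i], at offsets k + 1, …, k + t from i.  If k ≥ 2 and t ≥ 3, every far vertex has two far
-- neighbours, so no such sequence exists.  Otherwise the far side induces a path; only an end e of what
-- remains of it can be played, e ∉ C unless e is all that remains, and e then footprints exactly its
-- neighbour on the path.  This is the recursion defining a good configuration; conversely, a good
-- configuration is played off in this order after i and completed by a neighbour of i.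

open import Defs
open import Data.Bool using (Bool; true; false; T; _∧_; _∨_; not)
open import Data.Bool.Properties using (T-≡; T-∧; T-∨)
open import Data.Empty using (⊥; ⊥-elim)
open import Data.Fin as Fin using (Fin; toℕ)
open import Data.Fin.Properties using (toℕ-injective; toℕ<n; toℕ-fromℕ<; all?; ¬∀⟶∃¬)
open import Data.Fin.Subset using (Subset; inside; _∈_; _∉_; _∪_; ∣_∣; ⋃; _⊆_; ⁅_⁆)
open import Data.Fin.Subset.Properties
  using (_∈?_; x∈p∪q⁻; x∈p∪q⁺; p⊂q⇒∣p∣<∣q∣; ∣p∣≤n; ∉⊥; x∈⁅x⁆; x∈⁅y⁆⇒x≡y; ∣⊥∣≡0; ∣⁅x⁆∣≡1; ∈⊤; ∣⊤∣≡n; ⊆-antisym; ∪-comm)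
open import Data.List using (List; []; _∷_; _++_; length; map; lookup; initLast; _∷ʳ′_)
open import Data.List.Properties using (foldr-preservesᵇ; foldr-preservesᵒ; length-++; length-map; ++-assoc)
open import Data.List.Membership.Propositional using () renaming (_∈_ to _∈ₗ_; _∉_ to _∉ₗ_)
open import Data.List.Membership.Propositional.Properties using (∈-allFin; ∈-map⁺; ∈-map⁻; ∈-++⁺ˡ; ∈-++⁺ʳ; ∈-++⁻)
open import Data.List.Relation.Binary.Permutation.Propositional using (_↭_; ↭-sym; ↭-trans; ↭-swap; ↭-refl; ↭⇒↭ₛ)
open import Data.List.Relation.Binary.Permutation.Propositional.Properties using (∈-resp-↭; ↭-length; ++-comm)
import Data.List.Relation.Binary.Permutation.Setoid.Properties as Permutationₛ
open import Data.List.Relation.Unary.All as All using (All; []; _∷_)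
import Data.List.Relation.Unary.All.Properties as All
open import Data.List.Relation.Unary.AllPairs using ([]; _∷_)
open import Data.List.Relation.Unary.Any as Any using (here; there)
open import Data.List.Relation.Unary.Unique.Propositional using (Unique)
import Data.List.Relation.Unary.Unique.Propositional.Properties as Unique
open import Data.Nat
open import Data.Nat.DivMod using (_mod_; _%_; m%n<n; m<n⇒m%n≡m; [m+n]%n≡m%n)
open import Data.Nat.Properties
open import Data.Nat.Tactic.RingSolver using (solve-∀)
open import Data.Product using (_×_; _,_; proj₁; proj₂; ∃-syntax)
import Data.Sum as Sum
open import Data.Sum using (_⊎_; inj₁; inj₂; [_,_]′)
open import Data.Unit using (⊤; tt)
import Data.Vec as Vec
open import Data.Vec using (tabulate)
open import Data.Vec.Properties using (lookup∘tabulate; []=⇒lookup; lookup⇒[]=)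
open import Function using (_∘_; id; case_of_)
open import Function.Bundles using (_⇔_; mk⇔; Equivalence)
open import Function.Construct.Composition using (_⇔-∘_)
open import Function.Construct.Symmetry using (⇔-sym)
open import Relation.Nullary using (¬_; Dec; does; yes; no)
open import Relation.Binary.PropositionalEquality

open import Algebra.Properties.CommutativeSemigroup +-commutativeSemigroup using (x∙yz≈y∙xz)
open Equivalence using (to; from)

-- Lists, natural numbers and finite subsets

module _ {A : Set} {x : A} {xs : List A} where

  Unique-∷ : x ∉ₗ xs → Unique xs → Unique (x ∷ xs)
  Unique-∷ x∉xs xs! = All.¬Any⇒All¬ xs x∉xs ∷ xs!

  Unique-head : Unique (x ∷ xs) → x ∉ₗ xs
  Unique-head (x∉xs ∷ _) = All.All¬⇒¬Any x∉xs

  Unique-tail : Unique (x ∷ xs) → Unique xs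
  Unique-tail (_ ∷ xs!) = xs!

Unique-resp-↭ : ∀ {A : Set} {xs ys : List A} → xs ↭ ys → Unique xs → Unique ys
Unique-resp-↭ {A} xs↭ys = Permutationₛ.Unique-resp-↭ (setoid A) (↭⇒↭ₛ xs↭ys)

range : ℕ → ℕ → List ℕ
range a zero    = []
range a (suc s) = a ∷ range (suc a) s

∈-range⁻ : ∀ a s {x} → x ∈ₗ range a s → a ≤ x × x < a + s
∈-range⁻ a (suc s) (here refl) = ≤-refl , m<m+n a z<s
∈-range⁻ a (suc s) {x} (there x∈) =
  let a<x , x<sa+s = ∈-range⁻ (suc a) s x∈ in <⇒≤ a<x , subst (x <_) (sym (+-suc a s)) x<sa+s

∈-range⁺ : ∀ a s {x} → a ≤ x → x < a + s → x ∈ₗ range a s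
∈-range⁺ a zero a≤x x<a+0 = ⊥-elim (<⇒≱ x<a+0 (subst (_≤ _) (sym (+-identityʳ a)) a≤x))
∈-range⁺ a (suc s) {x} a≤x x<a+s with a ≟ x
... | yes refl = here refl
... | no a≢x = there (∈-range⁺ (suc a) s (≤∧≢⇒< a≤x a≢x) (subst (x <_) (+-suc a s) x<a+s))

range-unique : ∀ a s → Unique (range a s)
range-unique a zero    = []
range-unique a (suc s) = Unique-∷ (λ a∈ → 1+n≰n (proj₁ (∈-range⁻ (suc a) s a∈))) (range-unique (suc a) s)

length-range : ∀ a s → length (range a s) ≡ s
length-range a zero    = refl
length-range a (suc s) = cong suc (length-range (suc a) s)

lookup-map-range : ∀ {A : Set} (f : ℕ → A) a s (i : Fin (length (map f (range a s)))) →
                   lookup (map f (range a s)) i ≡ f (a + toℕ i) × toℕ i < s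
lookup-map-range f a (suc s) Fin.zero    = cong f (sym (+-identityʳ a)) , z<s
lookup-map-range f a (suc s) (Fin.suc i) =
  let e , i<s = lookup-map-range f (suc a) s i in trans e (cong f (sym (+-suc a (toℕ i)))) , s≤s i<s

∣n-1+n∣≡1 : ∀ n → ∣ n - suc n ∣ ≡ 1
∣n-1+n∣≡1 zero    = refl
∣n-1+n∣≡1 (suc n) = ∣n-1+n∣≡1 n

∣n-2+n∣≡2 : ∀ n → ∣ n - suc (suc n) ∣ ≡ 2
∣n-2+n∣≡2 zero    = refl
∣n-2+n∣≡2 (suc n) = ∣n-2+n∣≡2 n

∣m-n∣≡1⇒ : ∀ m n → ∣ m - n ∣ ≡ 1 → n ≡ suc m ⊎ m ≡ suc n
∣m-n∣≡1⇒ zero    n       d≡1 = inj₁ d≡1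
∣m-n∣≡1⇒ (suc m) zero    d≡1 = inj₂ (cong suc (suc-injective d≡1))
∣m-n∣≡1⇒ (suc m) (suc n) d≡1 = Sum.map (cong suc) (cong suc) (∣m-n∣≡1⇒ m n d≡1)

∣p∪q∣≤∣p∣+∣q∣ : ∀ {m} (p q : Subset m) → ∣ p ∪ q ∣ ≤ ∣ p ∣ + ∣ q ∣
∣p∪q∣≤∣p∣+∣q∣ Vec.[] Vec.[] = z≤n
∣p∪q∣≤∣p∣+∣q∣ (true Vec.∷ p) (true Vec.∷ q) =
  s≤s (≤-trans (∣p∪q∣≤∣p∣+∣q∣ p q) (≤-trans (n≤1+n _) (≤-reflexive (sym (+-suc ∣ p ∣ ∣ q ∣)))))
∣p∪q∣≤∣p∣+∣q∣ (true Vec.∷ p) (false Vec.∷ q) = s≤s (∣p∪q∣≤∣p∣+∣q∣ p q)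
∣p∪q∣≤∣p∣+∣q∣ (false Vec.∷ p) (true Vec.∷ q) =
  ≤-trans (s≤s (∣p∪q∣≤∣p∣+∣q∣ p q)) (≤-reflexive (sym (+-suc ∣ p ∣ ∣ q ∣)))
∣p∪q∣≤∣p∣+∣q∣ (false Vec.∷ p) (false Vec.∷ q) = ∣p∪q∣≤∣p∣+∣q∣ p q

module _ {n : ℕ} where

  ∣p∣<∣p∪q∣ : ∀ (p q : Subset n) {w} → w ∈ q → w ∉ p → ∣ p ∣ < ∣ p ∪ q ∣
  ∣p∣<∣p∪q∣ p q w∈q w∉p = p⊂q⇒∣p∣<∣q∣ (x∈p∪q⁺ ∘ inj₁ , _ , x∈p∪q⁺ (inj₂ w∈q) , w∉p)

  2+∣p∣≤∣p∪q∣ : ∀ (p q : Subset n) {w₁ w₂} → w₁ ≢ w₂ → w₁ ∈ q → w₂ ∈ q → w₁ ∉ p → w₂ ∉ p →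
                2 + ∣ p ∣ ≤ ∣ p ∪ q ∣
  2+∣p∣≤∣p∪q∣ p q {w₁} {w₂} w₁≢w₂ w₁∈q w₂∈q w₁∉p w₂∉p =
    ≤-trans (s≤s (∣p∣<∣p∪q∣ p ⁅ w₁ ⁆ (x∈⁅x⁆ w₁) w₁∉p)) (p⊂q⇒∣p∣<∣q∣ (p∪w₁⊆p∪q , w₂ , x∈p∪q⁺ (inj₂ w₂∈q) , w₂∉p∪w₁))
    where
    p∪w₁⊆p∪q : p ∪ ⁅ w₁ ⁆ ⊆ p ∪ q
    p∪w₁⊆p∪q x∈ with x∈p∪q⁻ p ⁅ w₁ ⁆ x∈
    ... | inj₁ x∈p = x∈p∪q⁺ (inj₁ x∈p)
    ... | inj₂ x∈w₁ rewrite x∈⁅y⁆⇒x≡y w₁ x∈w₁ = x∈p∪q⁺ (inj₂ w₁∈q)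
    w₂∉p∪w₁ : w₂ ∉ p ∪ ⁅ w₁ ⁆
    w₂∉p∪w₁ w₂∈ = [ w₂∉p , (λ w₂∈w₁ → w₁≢w₂ (sym (x∈⁅y⁆⇒x≡y w₁ w₂∈w₁))) ]′ (x∈p∪q⁻ p ⁅ w₁ ⁆ w₂∈)

  ∣p∣<n : ∀ (p : Subset n) {w} → w ∉ p → ∣ p ∣ < n
  ∣p∣<n p w∉p = subst (∣ p ∣ <_) (∣⊤∣≡n n) (p⊂q⇒∣p∣<∣q∣ ((λ _ → ∈⊤) , _ , ∈⊤ , w∉p))

  fromList : List (Fin n) → Subset n
  fromList xs = ⋃ (map ⁅_⁆ xs)

  ∈-fromList : ∀ xs {w} → w ∈ fromList xs ⇔ w ∈ₗ xs
  ∈-fromList xs = mk⇔ (to′ xs) (from′ xs)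
    where
    to′ : ∀ xs {w} → w ∈ fromList xs → w ∈ₗ xs
    to′ [] w∈ = ⊥-elim (∉⊥ w∈)
    to′ (x ∷ xs) w∈ = [ here ∘ x∈⁅y⁆⇒x≡y x , there ∘ to′ xs ]′ (x∈p∪q⁻ ⁅ x ⁆ (fromList xs) w∈)
    from′ : ∀ xs {w} → w ∈ₗ xs → w ∈ fromList xs
    from′ (x ∷ xs) (here refl) = x∈p∪q⁺ (inj₁ (x∈⁅x⁆ x))
    from′ (x ∷ xs) (there w∈) = x∈p∪q⁺ (inj₂ (from′ xs w∈))

  ∣fromList∣≡length : ∀ {xs} → Unique xs → ∣ fromList xs ∣ ≡ length xs
  ∣fromList∣≡length {[]} _ = ∣⊥∣≡0 n
  ∣fromList∣≡length {x ∷ xs} x∷xs! = ≤-antisym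
    (begin
      ∣ ⁅ x ⁆ ∪ fromList xs ∣         ≤⟨ ∣p∪q∣≤∣p∣+∣q∣ ⁅ x ⁆ (fromList xs) ⟩
      ∣ ⁅ x ⁆ ∣ + ∣ fromList xs ∣     ≡⟨ cong₂ _+_ (∣⁅x⁆∣≡1 x) IH ⟩
      suc (length xs)                 ∎)
    (begin
      suc (length xs)                 ≡⟨ cong suc (sym IH) ⟩
      suc ∣ fromList xs ∣             ≤⟨ ∣p∣<∣p∪q∣ (fromList xs) ⁅ x ⁆ (x∈⁅x⁆ x)
                                             (Unique-head x∷xs! ∘ ∈-fromList xs .to) ⟩
      ∣ fromList xs ∪ ⁅ x ⁆ ∣         ≡⟨ cong ∣_∣ (∪-comm (fromList xs) ⁅ x ⁆) ⟩
      ∣ ⁅ x ⁆ ∪ fromList xs ∣         ∎)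
    where
    open ≤-Reasoning
    IH = ∣fromList∣≡length (Unique-tail x∷xs!)

  ∣p∣≡length : ∀ (p : Subset n) {xs} → Unique xs → (∀ {w} → w ∈ p ⇔ w ∈ₗ xs) → ∣ p ∣ ≡ length xs
  ∣p∣≡length p {xs} xs! p≡xs = trans (cong ∣_∣ p≡fromList) (∣fromList∣≡length xs!)
    where
    p≡fromList : p ≡ fromList xs
    p≡fromList = ⊆-antisym (∈-fromList xs .from ∘ p≡xs .to) (p≡xs .from ∘ ∈-fromList xs .to)

toSide≡inside⇔T : ∀ b → toSide b ≡ inside ⇔ T b
toSide≡inside⇔T true  = mk⇔ _ (λ _ → refl)
toSide≡inside⇔T false = mk⇔ (λ ()) (λ ())

∈-tabulate : ∀ {n} (f : Fin n → Bool) {w} → w ∈ tabulate (λ v → toSide (f v)) ⇔ T (f w)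
∈-tabulate f {w} = mk⇔
  (λ w∈ → toSide≡inside⇔T (f w) .to (trans (sym (lookup∘tabulate _ w)) ([]=⇒lookup w∈)))
  (λ t → lookup⇒[]= w _ (trans (lookup∘tabulate _ w) (toSide≡inside⇔T (f w) .from t)))

T-does : ∀ {P : Set} (P? : Dec P) → T (does P?) ⇔ P
T-does (yes p) = mk⇔ (λ _ → p) _
T-does (no ¬p) = mk⇔ (λ ()) ¬p

T-not-does : ∀ {P : Set} (P? : Dec P) → T (not (does P?)) ⇔ (¬ P)
T-not-does (yes p) = mk⇔ (λ ()) (λ ¬p → ¬p p)
T-not-does (no ¬p) = mk⇔ (λ _ → ¬p) _

module Adjacency (n k : ℕ) where

  -- A record rather than the bare equation, so that its two vertices can be inferred.
  record Adj (v w : Fin n) : Set where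
    constructor adjacent
    field adj≡true : adj n k v w ≡ true

  open Adj public

  adj-comm : ∀ v w → adj n k v w ≡ adj n k w v
  adj-comm v w = cong₂ (λ b d → not b ∧ ((d ≤ᵇ k) ∨ (n ∸ k ≤ᵇ d))) does-≟-comm (∣-∣-comm (toℕ v) (toℕ w))
    where
    does-≟-comm : does (v Fin.≟ w) ≡ does (w Fin.≟ v)
    does-≟-comm with v Fin.≟ w | w Fin.≟ v
    ... | yes _   | yes _   = refl
    ... | no _    | no _    = refl
    ... | yes v≡w | no w≢v  = ⊥-elim (w≢v (sym v≡w))
    ... | no v≢w  | yes w≡v = ⊥-elim (v≢w (sym w≡v))

  Adj-sym : ∀ {v w} → Adj v w → Adj w v
  Adj-sym {v} {w} (adjacent v~w) = adjacent (trans (adj-comm w v) v~w)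

  adj-irrefl : ∀ v → adj n k v v ≡ false
  adj-irrefl v with v Fin.≟ v
  ... | yes _   = refl
  ... | no v≢v = ⊥-elim (v≢v refl)

  Adj-irrefl : ∀ {v} → ¬ Adj v v
  Adj-irrefl {v} (adjacent v~v) = case trans (sym v~v) (adj-irrefl v) of λ ()

module Neighbourhoods (n k : ℕ) (C : Subset n) where

  open Adjacency n k public

  N : Fin n → Subset n
  N = Nang n k C

  ∈-N⁻ : ∀ v {w} → w ∈ N v → (w ≡ v × v ∈ C) ⊎ Adj v w
  ∈-N⁻ v {w} w∈ = Sum.map (λ t → let (e , c) = T-∧ .to t in T-does (w Fin.≟ v) .to e , T-does (v ∈? C) .to c)
                            (adjacent ∘ T-≡ .to) (T-∨ .to (∈-tabulate _ .to w∈))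

  ∈-N-adj : ∀ {v w} → Adj v w → w ∈ N v
  ∈-N-adj (adjacent v~w) = ∈-tabulate _ .from (T-∨ .from (inj₂ (T-≡ .from v~w)))

  ∈-N-self : ∀ {v} → v ∈ C → v ∈ N v
  ∈-N-self {v} v∈C =
    ∈-tabulate _ .from (T-∨ .from (inj₁ (T-∧ .from (T-does (v Fin.≟ v) .from refl , T-does (v ∈? C) .from v∈C))))

  ∈-Nclosed⁻ : ∀ v {w} → w ∈ Nclosed n k v → w ≡ v ⊎ Adj v w
  ∈-Nclosed⁻ v {w} w∈ = Sum.map (T-does (w Fin.≟ v) .to) (adjacent ∘ T-≡ .to) (T-∨ .to (∈-tabulate _ .to w∈))

  ∈-Nclosed-adj : ∀ {v w} → Adj v w → w ∈ Nclosed n k v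
  ∈-Nclosed-adj (adjacent v~w) = ∈-tabulate _ .from (T-∨ .from (inj₂ (T-≡ .from v~w)))

  ∈-Nclosed-self : ∀ v → v ∈ Nclosed n k v
  ∈-Nclosed-self v = ∈-tabulate _ .from (T-∨ .from (inj₁ (T-does (v Fin.≟ v) .from refl)))

  ∉C⇒∉N-self : ∀ {v} → v ∉ C → v ∉ N v
  ∉C⇒∉N-self {v} v∉C v∈Nv with ∈-N⁻ v v∈Nv
  ... | inj₁ (_ , v∈C) = v∉C v∈C
  ... | inj₂ v~v       = Adj-irrefl v~v

-- Arithmetic modulo n

≢⇔1≤∣-∣ : ∀ {n} {x y : Fin n} → x ≢ y ⇔ 1 ≤ ∣ toℕ x - toℕ y ∣
≢⇔1≤∣-∣ {x = x} = mk⇔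
  (λ x≢y → n≢0⇒n>0 (x≢y ∘ toℕ-injective ∘ ∣m-n∣≡0⇒m≡n))
  (λ { 1≤d refl → <⇒≢ 1≤d (sym (∣n-n∣≡0 (toℕ x))) })

%-of-<2n : ∀ {m n} .⦃ _ : NonZero n ⦄ → m < n + n → m % n ≡ m ⊎ m % n + n ≡ m
%-of-<2n {m} {n} m<2n with m <? n
... | yes m<n = inj₁ (m<n⇒m%n≡m m<n)
... | no m≮n = inj₂ (begin
  m % n + n             ≡⟨ cong (λ x → x % n + n) (sym (m∸n+n≡m n≤m)) ⟩
  (m ∸ n + n) % n + n   ≡⟨ cong (_+ n) ([m+n]%n≡m%n (m ∸ n) n) ⟩
  (m ∸ n) % n + n       ≡⟨ cong (_+ n) (m<n⇒m%n≡m m∸n<n) ⟩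
  m ∸ n + n             ≡⟨ m∸n+n≡m n≤m ⟩
  m                     ∎)
  where
  open ≡-Reasoning
  n≤m = ≮⇒≥ m≮n
  m∸n<n : m ∸ n < n
  m∸n<n = +-cancelʳ-< n (m ∸ n) n (subst (_< n + n) (sym (m∸n+n≡m n≤m)) m<2n)

module Cyclic (n k : ℕ) ⦃ _ : NonZero n ⦄ where

  open Adjacency n k

  Close : ℕ → Set
  Close d = 1 ≤ d × (d ≤ k ⊎ n ∸ k ≤ d)

  infix 4 _~_
  _~_ : ℕ → ℕ → Set
  x ~ y = Close ∣ x - y ∣

  ~-comm : ∀ x y → x ~ y ⇔ y ~ x
  ~-comm x y = mk⇔ (subst Close (∣-∣-comm x y)) (subst Close (∣-∣-comm y x))

  Adj⇔~ : ∀ {x y : Fin n} → Adj x y ⇔ toℕ x ~ toℕ y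
  Adj⇔~ {x} {y} = mk⇔
    (λ (adjacent e) → let (x≢y , near) = T-∧ .to (T-≡ .from e) in
      ≢⇔1≤∣-∣ .to (T-not-does (x Fin.≟ y) .to x≢y) , Sum.map (≤ᵇ⇒≤ _ _) (≤ᵇ⇒≤ _ _) (T-∨ .to near))
    (λ (1≤d , near) → adjacent (T-≡ .to (T-∧ .from
      (T-not-does (x Fin.≟ y) .from (≢⇔1≤∣-∣ .from 1≤d) , T-∨ .from (Sum.map ≤⇒≤ᵇ ≤⇒≤ᵇ near)))))

  Close-complement : ∀ {e d} → e + d ≡ n → 1 ≤ d → Close e → Close d
  Close-complement {d = d} e+d≡n 1≤d (_ , inj₁ e≤k) =
    1≤d , inj₂ (m≤n+o⇒m∸n≤o n k (subst (_≤ k + d) e+d≡n (+-monoˡ-≤ d e≤k)))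
  Close-complement {e} {d} e+d≡n 1≤d (_ , inj₂ n∸k≤e) = 1≤d , inj₁ (+-cancelˡ-≤ e d k (begin
    e + d        ≡⟨ e+d≡n ⟩
    n            ≤⟨ m≤n+m∸n n k ⟩
    k + (n ∸ k)  ≤⟨ +-monoʳ-≤ k n∸k≤e ⟩
    k + e        ≡⟨ +-comm k e ⟩
    e + k        ∎))
    where open ≤-Reasoning

  -- y ≡ x + d (mod n), with at most one wrap-around.
  data Shift (x d y : ℕ) : Set where
    direct  : x + d ≡ y → Shift x d y
    wrapped : x + d ≡ y + n → Shift x d y

  Shift-~⇔Close : ∀ {x d y} → x < n → d < n → Shift x d y → x ~ y ⇔ Close d
  Shift-~⇔Close {x} {d} _ _ (direct refl) = mk⇔ (subst Close (∣m-m+n∣≡n x d)) (subst Close (sym (∣m-m+n∣≡n x d)))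
  Shift-~⇔Close {x} {d} {y} x<n d<n (wrapped x+d≡y+n) = mk⇔
    (λ x~y → Close-complement e+d≡n 1≤d (subst Close ∣x-y∣≡e x~y))
    (λ close → subst Close (sym ∣x-y∣≡e) (Close-complement (trans (+-comm d e) e+d≡n) 1≤e close))
    where
    y<x : y < x
    y<x = +-cancelʳ-< d y x (subst (y + d <_) (sym x+d≡y+n) (+-monoʳ-< y d<n))
    e = x ∸ y
    y+e≡x : y + e ≡ x
    y+e≡x = m+[n∸m]≡n (<⇒≤ y<x)
    1≤e : 1 ≤ e
    1≤e = m<n⇒0<n∸m y<x
    e+d≡n : e + d ≡ n
    e+d≡n = +-cancelˡ-≡ y (e + d) n (trans (sym (+-assoc y e d)) (trans (cong (_+ d) y+e≡x) x+d≡y+n))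
    ∣x-y∣≡e : ∣ x - y ∣ ≡ e
    ∣x-y∣≡e = m≤n⇒∣n-m∣≡n∸m (<⇒≤ y<x)
    1≤d : 1 ≤ d
    1≤d = n≢0⇒n>0 λ d≡0 → <⇒≱ x<n
      (subst (n ≤_) (trans (sym x+d≡y+n) (trans (cong (x +_) d≡0) (+-identityʳ x))) (m≤n+m n y))

  Shift-functional : ∀ {x d y y′} → y < n → y′ < n → Shift x d y → Shift x d y′ → y ≡ y′
  Shift-functional _ _ (direct e) (direct e′) = trans (sym e) e′
  Shift-functional _ _ (wrapped e) (wrapped e′) = +-cancelʳ-≡ n _ _ (trans (sym e) e′)
  Shift-functional {y′ = y′} y<n _ (direct e) (wrapped e′) =
    ⊥-elim (<⇒≱ y<n (subst (n ≤_) (trans (sym e′) e) (m≤n+m n y′)))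
  Shift-functional {y = y} _ y′<n (wrapped e) (direct e′) =
    ⊥-elim (<⇒≱ y′<n (subst (n ≤_) (trans (sym e) e′) (m≤n+m n y)))

  Shift-injective : ∀ {x d d′ y} → d < n → d′ < n → Shift x d y → Shift x d′ y → d ≡ d′
  Shift-injective _ _ (direct e) (direct e′) = +-cancelˡ-≡ _ _ _ (trans e (sym e′))
  Shift-injective _ _ (wrapped e) (wrapped e′) = +-cancelˡ-≡ _ _ _ (trans e (sym e′))
  Shift-injective {x} {d} {d′} _ d′<n (direct e) (wrapped e′) =
    ⊥-elim (<⇒≱ d′<n (subst (n ≤_) (sym d′≡d+n) (m≤n+m n d)))
    where
    d′≡d+n : d′ ≡ d + n
    d′≡d+n = +-cancelˡ-≡ x _ _ (trans e′ (trans (cong (_+ n) (sym e)) (+-assoc x d n)))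
  Shift-injective d<n d′<n (wrapped e) (direct e′) = sym (Shift-injective d′<n d<n (direct e′) (wrapped e))

  Shift-∸ : ∀ {x a b ya yb} → yb < n → a ≤ b → Shift x a ya → Shift x b yb → Shift ya (b ∸ a) yb
  Shift-∸ {x} {a} {b} {ya} {yb} yb<n a≤b = go
    where
    d = b ∸ a
    x+b≡x+a+d : x + b ≡ x + a + d
    x+b≡x+a+d = trans (cong (x +_) (sym (m+[n∸m]≡n a≤b))) (sym (+-assoc x a d))
    go : Shift x a ya → Shift x b yb → Shift ya d yb
    go (direct ea) (direct eb) = direct (trans (cong (_+ d) (sym ea)) (trans (sym x+b≡x+a+d) eb))
    go (direct ea) (wrapped eb) = wrapped (trans (cong (_+ d) (sym ea)) (trans (sym x+b≡x+a+d) eb))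
    go (wrapped ea) (wrapped eb) = direct (+-cancelʳ-≡ n _ _ (begin
      ya + d + n  ≡⟨ +-assoc ya d n ⟩
      ya + (d + n) ≡⟨ cong (ya +_) (+-comm d n) ⟩
      ya + (n + d) ≡⟨ sym (+-assoc ya n d) ⟩
      ya + n + d  ≡⟨ cong (_+ d) (sym ea) ⟩
      x + a + d   ≡⟨ sym x+b≡x+a+d ⟩
      x + b       ≡⟨ eb ⟩
      yb + n      ∎))
      where open ≡-Reasoning
    go (wrapped ea) (direct eb) = ⊥-elim (<⇒≱ yb<n (begin
      n             ≤⟨ m≤n+m n ya ⟩
      ya + n        ≡⟨ sym ea ⟩
      x + a         ≤⟨ m≤m+n (x + a) d ⟩
      x + a + d     ≡⟨ sym x+b≡x+a+d ⟩
      x + b         ≡⟨ eb ⟩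
      yb            ∎))
      where open ≤-Reasoning

  infixl 6 _⊕_ _⊖_

  _⊕_ : Fin n → ℕ → Fin n
  h ⊕ j = (toℕ h + j) mod n

  _⊖_ : Fin n → Fin n → ℕ
  w ⊖ h = (toℕ w + (n ∸ toℕ h)) % n

  private
    h+[w+[n∸h]]≡w+n : ∀ (w h : Fin n) → toℕ h + (toℕ w + (n ∸ toℕ h)) ≡ toℕ w + n
    h+[w+[n∸h]]≡w+n w h = begin
      toℕ h + (toℕ w + (n ∸ toℕ h))  ≡⟨ x∙yz≈y∙xz (toℕ h) (toℕ w) _ ⟩
      toℕ w + (toℕ h + (n ∸ toℕ h))  ≡⟨ cong (toℕ w +_) (m+[n∸m]≡n (<⇒≤ (toℕ<n h))) ⟩
      toℕ w + n                      ∎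
      where open ≡-Reasoning

  ⊖<n : ∀ w h → w ⊖ h < n
  ⊖<n w h = m%n<n _ n

  Shift-⊕ : ∀ h {j} → j < n → Shift (toℕ h) j (toℕ (h ⊕ j))
  Shift-⊕ h j<n with %-of-<2n (+-mono-< (toℕ<n h) j<n)
  ... | inj₁ e = direct (sym (trans (toℕ-fromℕ< _) e))
  ... | inj₂ e = wrapped (sym (trans (cong (_+ n) (toℕ-fromℕ< _)) e))

  Shift-⊖ : ∀ w h → Shift (toℕ h) (w ⊖ h) (toℕ w)
  Shift-⊖ w h with %-of-<2n (+-mono-<-≤ (toℕ<n w) (m∸n≤m n (toℕ h)))
  ... | inj₁ e = wrapped (trans (cong (toℕ h +_) e) (h+[w+[n∸h]]≡w+n w h))
  ... | inj₂ e = direct (+-cancelʳ-≡ n _ _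
                   (trans (+-assoc (toℕ h) _ n) (trans (cong (toℕ h +_) e) (h+[w+[n∸h]]≡w+n w h))))


  0<n : 0 < n
  0<n = >-nonZero⁻¹ n

  ⊕-⊖ : ∀ h w → h ⊕ (w ⊖ h) ≡ w
  ⊕-⊖ h w = toℕ-injective (Shift-functional (toℕ<n _) (toℕ<n w) (Shift-⊕ h (⊖<n w h)) (Shift-⊖ w h))

  ⊖-⊕ : ∀ h {j} → j < n → (h ⊕ j) ⊖ h ≡ j
  ⊖-⊕ h j<n = Shift-injective (⊖<n _ h) j<n (Shift-⊖ (h ⊕ _) h) (Shift-⊕ h j<n)

  ⊕-injective : ∀ h {a b} → a < n → b < n → h ⊕ a ≡ h ⊕ b → a ≡ b
  ⊕-injective h a<n b<n e = trans (sym (⊖-⊕ h a<n)) (trans (cong (_⊖ h) e) (⊖-⊕ h b<n))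

  ⊕-zero : ∀ h → h ⊕ 0 ≡ h
  ⊕-zero h = toℕ-injective (Shift-functional (toℕ<n _) (toℕ<n h) (Shift-⊕ h 0<n) (direct (+-identityʳ (toℕ h))))

  ⊖-self : ∀ h → h ⊖ h ≡ 0
  ⊖-self h = trans (cong (_⊖ h) (sym (⊕-zero h))) (⊖-⊕ h 0<n)

  ⊖≡0⇒≡ : ∀ {w h} → w ⊖ h ≡ 0 → w ≡ h
  ⊖≡0⇒≡ {w} {h} w⊖h≡0 = trans (sym (⊕-⊖ h w)) (trans (cong (h ⊕_) w⊖h≡0) (⊕-zero h))

  private
    ⊕-~-≤ : ∀ h {a b} → a ≤ b → b < n → toℕ (h ⊕ a) ~ toℕ (h ⊕ b) ⇔ a ~ b
    ⊕-~-≤ h {a} {b} a≤b b<n =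
      ⇔-sym (Shift-~⇔Close a<n d<n (direct (m+[n∸m]≡n a≤b)))
      ⇔-∘ Shift-~⇔Close (toℕ<n _) d<n (Shift-∸ (toℕ<n _) a≤b (Shift-⊕ h a<n) (Shift-⊕ h b<n))
      where
      a<n = ≤-<-trans a≤b b<n
      d<n = ≤-<-trans (m∸n≤m b a) b<n

  ⊕-~ : ∀ h {a b} → a < n → b < n → toℕ (h ⊕ a) ~ toℕ (h ⊕ b) ⇔ a ~ b
  ⊕-~ h {a} {b} a<n b<n with ≤-total a b
  ... | inj₁ a≤b = ⊕-~-≤ h a≤b b<n
  ... | inj₂ b≤a = ~-comm b a ⇔-∘ (⊕-~-≤ h b≤a a<n ⇔-∘ ~-comm (toℕ (h ⊕ a)) (toℕ (h ⊕ b)))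

  Adj-⊕⇔~ : ∀ h {a b} → a < n → b < n → Adj (h ⊕ a) (h ⊕ b) ⇔ a ~ b
  Adj-⊕⇔~ h a<n b<n = ⊕-~ h a<n b<n ⇔-∘ Adj⇔~

  Bounded : List ℕ → Set
  Bounded xs = ∀ {x} → x ∈ₗ xs → x < n

  ∈-map-⊕ : ∀ h {xs w} → Bounded xs → w ∈ₗ map (h ⊕_) xs ⇔ w ⊖ h ∈ₗ xs
  ∈-map-⊕ h {xs} {w} bounded = mk⇔
    (λ w∈ → let x , x∈ , w≡h⊕x = ∈-map⁻ (h ⊕_) w∈ in
      subst (_∈ₗ xs) (sym (trans (cong (_⊖ h) w≡h⊕x) (⊖-⊕ h (bounded x∈)))) x∈)
    (λ w⊖h∈ → subst (_∈ₗ map (h ⊕_) xs) (⊕-⊖ h w) (∈-map⁺ (h ⊕_) w⊖h∈))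

  Unique-map-⊕ : ∀ h {xs} → Bounded xs → Unique xs → Unique (map (h ⊕_) xs)
  Unique-map-⊕ h {[]}     _       _      = []
  Unique-map-⊕ h {x ∷ xs} bounded x∷xs! = Unique-∷
    (λ h⊕x∈ → Unique-head x∷xs! (subst (_∈ₗ xs) (⊖-⊕ h (bounded (here refl))) (∈-map-⊕ h (bounded ∘ there) .to h⊕x∈)))
    (Unique-map-⊕ h (bounded ∘ there) (Unique-tail x∷xs!))

  Adj⇔~-⊖ : ∀ h v w → Adj v w ⇔ v ⊖ h ~ w ⊖ h
  Adj⇔~-⊖ h v w = Adj-⊕⇔~ h (⊖<n v h) (⊖<n w h) ⇔-∘ mk⇔ (subst₂ Adj (sym (⊕-⊖ h v)) (sym (⊕-⊖ h w)))
                                                         (subst₂ Adj (⊕-⊖ h v) (⊕-⊖ h w))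

  Adj⇔Close-⊖ : ∀ v w → Adj v w ⇔ Close (w ⊖ v)
  Adj⇔Close-⊖ v w = subst (λ z → Adj v w ⇔ Close ∣ z - w ⊖ v ∣) (⊖-self v) (Adj⇔~-⊖ v v w)

module Footprints (n k : ℕ) (C : Subset n) where

  open Neighbourhoods n k C

  covered : Subset n → List (Fin n) → Subset n
  covered acc []       = acc
  covered acc (v ∷ vs) = covered (acc ∪ N v) vs

  covered-++ : ∀ acc xs ys → covered acc (xs ++ ys) ≡ covered (covered acc xs) ys
  covered-++ acc []       ys = refl
  covered-++ acc (x ∷ xs) ys = covered-++ (acc ∪ N x) xs ys

  LegalFrom-++ : ∀ {acc} xs {ys} → LegalFrom n k C acc xs → LegalFrom n k C (covered acc xs) ys →
                 LegalFrom n k C acc (xs ++ ys)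
  LegalFrom-++ []       _              ys-legal = ys-legal
  LegalFrom-++ (x ∷ xs) (new , legal) ys-legal = new , LegalFrom-++ xs legal ys-legal

  acc⊆covered : ∀ {acc} vs → acc ⊆ covered acc vs
  acc⊆covered []       w∈ = w∈
  acc⊆covered (v ∷ vs) w∈ = acc⊆covered vs (x∈p∪q⁺ (inj₁ w∈))

  N⊆covered : ∀ {acc v} vs → v ∈ₗ vs → N v ⊆ covered acc vs
  N⊆covered (u ∷ vs) (here refl) w∈ = acc⊆covered vs (x∈p∪q⁺ (inj₂ w∈))
  N⊆covered (u ∷ vs) (there v∈)  w∈ = N⊆covered vs v∈ w∈

  N⊆covered-∷ : ∀ {v₀ v} vs → v ∈ₗ v₀ ∷ vs → N v ⊆ covered (N v₀) vs
  N⊆covered-∷ vs (here refl) = acc⊆covered vs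
  N⊆covered-∷ vs (there v∈)  = N⊆covered vs v∈

  ∈-covered⁻ : ∀ {acc} vs {w} → w ∈ covered acc vs → w ∈ acc ⊎ ∃[ v ] (v ∈ₗ vs × w ∈ N v)
  ∈-covered⁻ [] w∈ = inj₁ w∈
  ∈-covered⁻ {acc} (v ∷ vs) w∈ with ∈-covered⁻ vs w∈
  ... | inj₂ (u , u∈ , w∈Nu) = inj₂ (u , there u∈ , w∈Nu)
  ... | inj₁ w∈acc∪Nv = [ inj₁ , (λ w∈Nv → inj₂ (v , here refl , w∈Nv)) ]′ (x∈p∪q⁻ acc (N v) w∈acc∪Nv)

  ∈-⋃N : ∀ us {u w} → u ∈ₗ us → w ∈ N u → w ∈ ⋃ (map N us)
  ∈-⋃N (_ ∷ us) (here refl) w∈ = x∈p∪q⁺ (inj₁ w∈)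
  ∈-⋃N (_ ∷ us) (there u∈)  w∈ = x∈p∪q⁺ (inj₂ (∈-⋃N us u∈ w∈))

  Dominating-covered : ∀ v vs → (∀ w → w ∈ covered (N v) vs) → Dominating n k C (v ∷ vs)
  Dominating-covered v vs all-covered w with ∈-covered⁻ vs (all-covered w)
  ... | inj₁ w∈Nv            = ∈-⋃N (v ∷ vs) (here refl) w∈Nv
  ... | inj₂ (u , u∈ , w∈Nu) = ∈-⋃N (v ∷ vs) (there u∈) w∈Nu

  LegalFrom-step : ∀ {acc v vs} → LegalFrom n k C acc (v ∷ vs) →
                   suc (length vs) + ∣ acc ∣ ≤ length vs + ∣ acc ∪ N v ∣
  LegalFrom-step {acc} {v} {vs} ((w , w∈Nv , w∉acc) , _) = begin
    suc (length vs) + ∣ acc ∣  ≡⟨ sym (+-suc (length vs) ∣ acc ∣) ⟩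
    length vs + suc ∣ acc ∣    ≤⟨ +-monoʳ-≤ (length vs) (∣p∣<∣p∪q∣ acc (N v) w∈Nv w∉acc) ⟩
    length vs + ∣ acc ∪ N v ∣  ∎
    where open ≤-Reasoning

  LegalFrom-length : ∀ acc vs → LegalFrom n k C acc vs → length vs + ∣ acc ∣ ≤ n
  LegalFrom-length acc []       _ = ∣p∣≤n acc
  LegalFrom-length acc (v ∷ vs) legal = ≤-trans (LegalFrom-step legal) (LegalFrom-length (acc ∪ N v) vs (proj₂ legal))

  -- The bound of LegalFrom-length is attained: every step footprints exactly one new vertex.
  Tight : Subset n → List (Fin n) → Set
  Tight acc vs = n ≤ length vs + ∣ acc ∣

  Tight-∷ : ∀ {acc v vs} → LegalFrom n k C acc (v ∷ vs) → Tight acc (v ∷ vs) → Tight (acc ∪ N v) vs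
  Tight-∷ legal tight = ≤-trans tight (LegalFrom-step legal)

  Tight-new-unique : ∀ {acc v vs w₁ w₂} → LegalFrom n k C acc (v ∷ vs) → Tight acc (v ∷ vs) →
                     w₁ ∈ N v → w₂ ∈ N v → w₁ ∉ acc → w₂ ∉ acc → w₁ ≡ w₂
  Tight-new-unique {acc} {v} {vs} {w₁} {w₂} (_ , legal) tight w₁∈ w₂∈ w₁∉ w₂∉ with w₁ Fin.≟ w₂
  ... | yes w₁≡w₂ = w₁≡w₂
  ... | no w₁≢w₂ = ⊥-elim (1+n≰n (begin
    suc (suc (length vs + ∣ acc ∣))  ≡⟨ cong suc (sym (+-suc (length vs) ∣ acc ∣)) ⟩
    suc (length vs + suc ∣ acc ∣)    ≡⟨ sym (+-suc (length vs) (suc ∣ acc ∣)) ⟩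
    length vs + (2 + ∣ acc ∣)        ≤⟨ +-monoʳ-≤ (length vs) (2+∣p∣≤∣p∪q∣ acc (N v) w₁≢w₂ w₁∈ w₂∈ w₁∉ w₂∉) ⟩
    length vs + ∣ acc ∪ N v ∣        ≤⟨ LegalFrom-length (acc ∪ N v) vs legal ⟩
    n                                ≤⟨ tight ⟩
    suc (length vs + ∣ acc ∣)        ∎))
    where open ≤-Reasoning

  δ₁≤∣N∣ : ∀ v → δ₁ n k C ≤ ∣ N v ∣
  δ₁≤∣N∣ v = foldr-preservesᵒ (λ x y → [ ≤-trans (m⊓n≤m x y) , ≤-trans (m⊓n≤n x y) ]′) n _
    (inj₂ (Any.map (λ e → ≤-reflexive (sym e)) (∈-map⁺ (∣_∣ ∘ N) (∈-allFin v))))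

  ≤δ₁ : ∀ {c} → c ≤ n → (∀ v → c ≤ ∣ N v ∣) → c ≤ δ₁ n k C
  ≤δ₁ {c} c≤n c≤∣N∣ = foldr-preservesᵇ {P = c ≤_} {f = _⊓_} ⊓-glb c≤n (All.map⁺ (All.tabulate⁺ c≤∣N∣))

  Legal-length≤m₁ : ∀ vs → Legal n k C vs → length vs ≤ m₁ n k C
  Legal-length≤m₁ []       _          = z≤n
  Legal-length≤m₁ (v ∷ vs) (_ , legal) = begin
    suc (length vs)                  ≤⟨ s≤s (m+n≤o⇒m≤o∸n (length vs) (LegalFrom-length (N v) vs legal)) ⟩
    suc (n ∸ ∣ N v ∣)                ≤⟨ s≤s (∸-monoʳ-≤ n (δ₁≤∣N∣ v)) ⟩
    suc (n ∸ δ₁ n k C)               ≡⟨ +-comm 1 _ ⟩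
    m₁ n k C                         ∎
    where open ≤-Reasoning

module InducedPaths (n k : ℕ) where

  open Adjacency n k

  NonAdj : Fin n → Fin n → Set
  NonAdj v w = ¬ Adj v w

  HeadAdjacent : Fin n → List (Fin n) → Set
  HeadAdjacent x []       = ⊤
  HeadAdjacent x (y ∷ ys) = Adj x y × All (NonAdj x) ys

  InducedPath : List (Fin n) → Set
  InducedPath []       = ⊤
  InducedPath (x ∷ xs) = HeadAdjacent x xs × InducedPath xs

  InducedPath-++⁻ˡ : ∀ xs {ys} → InducedPath (xs ++ ys) → InducedPath xs
  InducedPath-++⁻ˡ []       _ = tt
  InducedPath-++⁻ˡ (x ∷ xs) (head , path) = head-++⁻ xs head , InducedPath-++⁻ˡ xs path
    where
    head-++⁻ : ∀ xs {ys} → HeadAdjacent x (xs ++ ys) → HeadAdjacent x xs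
    head-++⁻ []       _              = tt
    head-++⁻ (y ∷ xs) (x~y , others) = x~y , All.++⁻ˡ xs others

  InducedPath-++⁻ʳ : ∀ xs {ys} → InducedPath (xs ++ ys) → InducedPath ys
  InducedPath-++⁻ʳ []       path       = path
  InducedPath-++⁻ʳ (x ∷ xs) (_ , path) = InducedPath-++⁻ʳ xs path

  InducedPath-last : ∀ xs {x y} → InducedPath (xs ++ x ∷ y ∷ []) → All (NonAdj y) xs
  InducedPath-last []       _ = []
  InducedPath-last (z ∷ xs) (head , path) = z≁y xs head ∘ Adj-sym ∷ InducedPath-last xs path
    where
    z≁y : ∀ xs {x y} → HeadAdjacent z (xs ++ x ∷ y ∷ []) → NonAdj z y
    z≁y []       (_ , z≁y ∷ []) = z≁y
    z≁y (_ ∷ xs) (_ , others)   = All.lookup others (∈-++⁺ʳ xs (there (here refl)))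

  InducedPath-lookup : ∀ us → (∀ a b → adj n k (lookup us a) (lookup us b) ≡ true ⇔ (∣ toℕ a - toℕ b ∣ ≡ 1)) →
                       InducedPath us
  InducedPath-lookup []           _    = tt
  InducedPath-lookup (x ∷ [])     _    = tt , tt
  InducedPath-lookup (x ∷ y ∷ ys) path =
    (adjacent (path Fin.zero (Fin.suc Fin.zero) .from refl) ,
     nonadjacent ys (λ j x~ → case path Fin.zero (Fin.suc (Fin.suc j)) .to (adj≡true x~) of λ ())) ,
    InducedPath-lookup (y ∷ ys) (λ a b → path (Fin.suc a) (Fin.suc b))
    where
    nonadjacent : ∀ zs → (∀ j → ¬ Adj x (lookup zs j)) → All (NonAdj x) zs
    nonadjacent []       _     = []
    nonadjacent (z ∷ zs) x≁zs = x≁zs Fin.zero ∷ nonadjacent zs (x≁zs ∘ Fin.suc)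

  TwoNeighbours : (Fin n → Set) → Fin n → Set
  TwoNeighbours P v = ∃[ a ] ∃[ b ] (a ≢ b × P a × P b × Adj v a × Adj v b)

  TwoNeighbours-map : ∀ {P Q : Fin n → Set} {v} → (∀ {u} → Adj v u → P u → Q u) →
                      TwoNeighbours P v → TwoNeighbours Q v
  TwoNeighbours-map P⇒Q (a , b , a≢b , Pa , Pb , v~a , v~b) = a , b , a≢b , P⇒Q v~a Pa , P⇒Q v~b Pb , v~a , v~b

  Inner : List (Fin n) → Fin n → Set
  Inner us = TwoNeighbours (_∈ₗ us)

  neighbour-of-head : ∀ {y z zs u} → HeadAdjacent y (z ∷ zs) → u ∈ₗ y ∷ z ∷ zs → Adj y u → u ≡ z
  neighbour-of-head _          (here refl)          y~y = ⊥-elim (Adj-irrefl y~y)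
  neighbour-of-head _          (there (here refl))  _   = refl
  neighbour-of-head (_ , y≁zs) (there (there u∈zs)) y~u = ⊥-elim (All.lookup y≁zs u∈zs y~u)

  head-not-inner : ∀ {y ys} → InducedPath (y ∷ ys) → ¬ Inner (y ∷ ys) y
  head-not-inner {ys = []} _ (a , _ , _ , here refl , _ , y~y , _) = Adj-irrefl y~y
  head-not-inner {ys = _ ∷ _} (head , _) (a , b , a≢b , a∈ , b∈ , y~a , y~b) =
    a≢b (trans (neighbour-of-head head a∈ y~a) (sym (neighbour-of-head head b∈ y~b)))

  private
    last-only-neighbour : ∀ xs {z y b} → HeadAdjacent z (xs ++ y ∷ []) → Adj z y →
                          b ∈ₗ xs ++ y ∷ [] → ¬ Adj y b
    last-only-neighbour []       _ _ (here refl) y~y = Adj-irrefl y~y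
    last-only-neighbour (_ ∷ xs) (_ , z≁rest) z~y _ _ = All.lookup z≁rest (∈-++⁺ʳ xs (here refl)) z~y

  last-not-inner : ∀ xs {y} → InducedPath (xs ++ y ∷ []) → ¬ Inner (xs ++ y ∷ []) y
  last-not-inner []       _ (_ , _ , _ , here refl , _ , y~y , _) = Adj-irrefl y~y
  last-not-inner (z ∷ xs) (head , path) (a , b , a≢b , a∈ , b∈ , y~a , y~b) with a∈ | b∈
  ... | there a∈′ | there b∈′ = last-not-inner xs path (a , b , a≢b , a∈′ , b∈′ , y~a , y~b)
  ... | here refl | here refl = a≢b refl
  ... | here refl | there b∈′ = last-only-neighbour xs head (Adj-sym y~a) b∈′ y~b
  ... | there a∈′ | here refl = last-only-neighbour xs head (Adj-sym y~b) a∈′ y~a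

  position : ∀ {us v} → InducedPath us → Unique us → v ∈ₗ us →
             (∃[ ws ] us ≡ v ∷ ws) ⊎ (∃[ L ] ∃[ x ] us ≡ L ++ x ∷ v ∷ []) ⊎ Inner us v
  position {_ ∷ zs} _ _ (here refl) = inj₁ (zs , refl)
  position {z ∷ zs} (head , path) z∷zs! (there v∈zs) with position path (Unique-tail z∷zs!) v∈zs
  ... | inj₁ ([] , refl) = inj₂ (inj₁ ([] , z , refl))
  ... | inj₁ (w ∷ ws , refl) =
    inj₂ (inj₂ (z , w , z≢w , here refl , there (there (here refl)) , Adj-sym (proj₁ head) , proj₁ (proj₁ path)))
    where
    z≢w : z ≢ w
    z≢w z≡w = Unique-head z∷zs! (there (here z≡w))
  ... | inj₂ (inj₁ (L , x , refl)) = inj₂ (inj₁ (z ∷ L , x , refl))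
  ... | inj₂ (inj₂ inner) = inj₂ (inj₂ (TwoNeighbours-map (λ _ → there) inner))

-- Sequences from good configurations

module GoodConfigurations (n k : ℕ) (C : Subset n) where

  open Neighbourhoods n k C
  open Footprints n k C
  open InducedPaths n k

  Avoids : Subset n → List (Fin n) → Set
  Avoids acc us = ∀ {u} → u ∈ₗ us → u ∉ acc

  NeighboursWithin : Subset n → List (Fin n) → Set
  NeighboursWithin acc us = ∀ {u w} → u ∈ₗ us → w ∈ N u → w ∈ acc ⊎ w ∈ₗ us

  Avoids-resp-↭ : ∀ {acc us us′} → us ↭ us′ → Avoids acc us → Avoids acc us′
  Avoids-resp-↭ us↭us′ avoids = avoids ∘ ∈-resp-↭ (↭-sym us↭us′)

  NeighboursWithin-resp-↭ : ∀ {acc us us′} → us ↭ us′ → NeighboursWithin acc us → NeighboursWithin acc us′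
  NeighboursWithin-resp-↭ us↭us′ within u∈ w∈ =
    Sum.map₂ (∈-resp-↭ us↭us′) (within (∈-resp-↭ (↭-sym us↭us′) u∈) w∈)

  record LegalOrdering (acc : Subset n) (us : List (Fin n)) : Set where
    field
      seq      : List (Fin n)
      legal    : LegalFrom n k C acc seq
      unique   : Unique seq
      ⊆us      : ∀ {w} → w ∈ₗ seq → w ∈ₗ us
      length≡  : length seq ≡ length us
      covered⁻ : ∀ {w} → w ∈ covered acc seq → w ∈ acc ⊎ w ∈ₗ us
      covered⁺ : ∀ {w} → w ∈ₗ us → w ∈ covered acc seq

  LegalOrdering-[] : ∀ {acc} → LegalOrdering acc []
  LegalOrdering-[] = record
    { seq = [] ; legal = tt ; unique = [] ; ⊆us = λ () ; length≡ = refl ; covered⁻ = inj₁ ; covered⁺ = λ () }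

  LegalOrdering-resp-↭ : ∀ {acc us us′} → us ↭ us′ → LegalOrdering acc us → LegalOrdering acc us′
  LegalOrdering-resp-↭ us↭us′ O = record
    { seq = seq ; legal = legal ; unique = unique
    ; ⊆us = ∈-resp-↭ us↭us′ ∘ ⊆us
    ; length≡ = trans length≡ (↭-length us↭us′)
    ; covered⁻ = Sum.map₂ (∈-resp-↭ us↭us′) ∘ covered⁻
    ; covered⁺ = covered⁺ ∘ ∈-resp-↭ (↭-sym us↭us′) }
    where open LegalOrdering O

  LegalOrdering-single : ∀ {acc u} → u ∈ C → u ∉ acc → NeighboursWithin acc (u ∷ []) → LegalOrdering acc (u ∷ [])
  LegalOrdering-single {acc} {u} u∈C u∉acc within = record
    { seq = u ∷ [] ; legal = (u , ∈-N-self u∈C , u∉acc) , tt ; unique = [] ∷ []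
    ; ⊆us = id ; length≡ = refl
    ; covered⁻ = [ inj₁ , within (here refl) ]′ ∘ x∈p∪q⁻ acc (N u)
    ; covered⁺ = λ { (here refl) → x∈p∪q⁺ (inj₂ (∈-N-self u∈C)) } }

  -- Play e (footprinting x), then L, then x (footprinting e, as e ∉ C keeps e out of N e).
  LegalOrdering-peel : ∀ {acc e x L} → e ∉ C → Adj e x → All (NonAdj e) L → Unique (e ∷ x ∷ L) →
    Avoids acc (e ∷ x ∷ L) → NeighboursWithin acc (e ∷ x ∷ L) →
    (Avoids (acc ∪ N e) L → NeighboursWithin (acc ∪ N e) L → LegalOrdering (acc ∪ N e) L) →
    LegalOrdering acc (e ∷ x ∷ L)
  LegalOrdering-peel {acc} {e} {x} {L} e∉C e~x e≁L e∷x∷L! avoids within order-L = record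
    { seq = e ∷ (O.seq ++ x ∷ [])
    ; legal = (x , x∈Ne , avoids (there (here refl))) ,
              LegalFrom-++ O.seq O.legal ((e , e∈Nx , e∉covered) , tt)
    ; unique = Unique-∷ e∉seq (Unique.++⁺ O.unique ([] ∷ []) (λ { (w∈seq , here refl) → x∉L (O.⊆us w∈seq) }))
    ; ⊆us = ⊆us
    ; length≡ = cong suc (trans (length-++ O.seq) (trans (+-comm _ 1) (cong suc O.length≡)))
    ; covered⁻ = covered⁻
    ; covered⁺ = covered⁺
    }
    where
    x∈Ne : x ∈ N e
    x∈Ne = ∈-N-adj e~x
    e∈Nx : e ∈ N x
    e∈Nx = ∈-N-adj (Adj-sym e~x)
    e≢x : e ≢ x
    e≢x = Unique-head e∷x∷L! ∘ here
    e∉L : e ∉ₗ L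
    e∉L = Unique-head e∷x∷L! ∘ there
    x∉L : x ∉ₗ L
    x∉L = Unique-head (Unique-tail e∷x∷L!)

    avoids-L : Avoids (acc ∪ N e) L
    avoids-L u∈L u∈ with x∈p∪q⁻ acc (N e) u∈
    ... | inj₁ u∈acc = avoids (there (there u∈L)) u∈acc
    ... | inj₂ u∈Ne with ∈-N⁻ e u∈Ne
    ...   | inj₁ (refl , _) = e∉L u∈L
    ...   | inj₂ e~u = All.lookup e≁L u∈L e~u

    within-L : NeighboursWithin (acc ∪ N e) L
    within-L {u} u∈L w∈Nu with within (there (there u∈L)) w∈Nu
    ... | inj₁ w∈acc = inj₁ (x∈p∪q⁺ (inj₁ w∈acc))
    ... | inj₂ (there (here refl)) = inj₁ (x∈p∪q⁺ (inj₂ x∈Ne))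
    ... | inj₂ (there (there w∈L)) = inj₂ w∈L
    ... | inj₂ (here refl) with ∈-N⁻ u w∈Nu
    ...   | inj₁ (refl , _) = ⊥-elim (e∉L u∈L)
    ...   | inj₂ u~e = ⊥-elim (All.lookup e≁L u∈L (Adj-sym u~e))

    module O = LegalOrdering (order-L avoids-L within-L)

    e∉covered : e ∉ covered (acc ∪ N e) O.seq
    e∉covered e∈ with O.covered⁻ e∈
    ... | inj₂ e∈L = e∉L e∈L
    ... | inj₁ e∈acc∪Ne = [ avoids (here refl) , ∉C⇒∉N-self e∉C ]′ (x∈p∪q⁻ acc (N e) e∈acc∪Ne)

    e∉seq : e ∉ₗ O.seq ++ x ∷ []
    e∉seq e∈ = [ e∉L ∘ O.⊆us , (λ { (here e≡x) → e≢x e≡x }) ]′ (∈-++⁻ O.seq e∈)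

    ⊆us : ∀ {w} → w ∈ₗ e ∷ (O.seq ++ x ∷ []) → w ∈ₗ e ∷ x ∷ L
    ⊆us (here refl) = here refl
    ⊆us (there w∈) = [ there ∘ there ∘ O.⊆us , (λ { (here refl) → there (here refl) }) ]′ (∈-++⁻ O.seq w∈)

    covered-seq : covered acc (e ∷ (O.seq ++ x ∷ [])) ≡ covered (acc ∪ N e) O.seq ∪ N x
    covered-seq = covered-++ (acc ∪ N e) O.seq (x ∷ [])

    covered⁻ : ∀ {w} → w ∈ covered acc (e ∷ (O.seq ++ x ∷ [])) → w ∈ acc ⊎ w ∈ₗ e ∷ x ∷ L
    covered⁻ {w} w∈ with x∈p∪q⁻ (covered (acc ∪ N e) O.seq) (N x) (subst (w ∈_) covered-seq w∈)
    ... | inj₂ w∈Nx = within (there (here refl)) w∈Nx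
    ... | inj₁ w∈ with O.covered⁻ w∈
    ...   | inj₂ w∈L = inj₂ (there (there w∈L))
    ...   | inj₁ w∈acc∪Ne = [ inj₁ , within (here refl) ]′ (x∈p∪q⁻ acc (N e) w∈acc∪Ne)

    covered⁺ : ∀ {w} → w ∈ₗ e ∷ x ∷ L → w ∈ covered acc (e ∷ (O.seq ++ x ∷ []))
    covered⁺ {w} w∈ = subst (w ∈_) (sym covered-seq) (go w∈)
      where
      go : ∀ {w} → w ∈ₗ e ∷ x ∷ L → w ∈ covered (acc ∪ N e) O.seq ∪ N x
      go (here refl)         = x∈p∪q⁺ (inj₂ e∈Nx)
      go (there (here refl)) = x∈p∪q⁺ (inj₁ (acc⊆covered O.seq (x∈p∪q⁺ (inj₂ x∈Ne))))
      go (there (there w∈L)) = x∈p∪q⁺ (inj₁ (O.covered⁺ w∈L))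

  Gconf⇒LegalOrdering : ∀ {acc us} → Gconf C us → InducedPath us → Unique us →
                        Avoids acc us → NeighboursWithin acc us → LegalOrdering acc us
  Gconf⇒LegalOrdering (gc-one u∈C) _ _ avoids within = LegalOrdering-single u∈C (avoids (here refl)) within
  Gconf⇒LegalOrdering (gc-two {u₁} {u₂} not-both) ((u₁~u₂ , []) , _) us! avoids within with u₁ ∈? C
  ... | no u₁∉C = LegalOrdering-peel u₁∉C u₁~u₂ [] us! avoids within λ _ _ → LegalOrdering-[]
  ... | yes u₁∈C = LegalOrdering-resp-↭ (↭-sym swap)
        (LegalOrdering-peel (λ u₂∈C → not-both (u₁∈C , u₂∈C)) (Adj-sym u₁~u₂) []
          (Unique-resp-↭ swap us!) (Avoids-resp-↭ swap avoids) (NeighboursWithin-resp-↭ swap within)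
          λ _ _ → LegalOrdering-[])
    where
    swap : u₁ ∷ u₂ ∷ [] ↭ u₂ ∷ u₁ ∷ []
    swap = ↭-swap u₁ u₂ ↭-refl
  Gconf⇒LegalOrdering (gc-left u₁∉C g) ((u₁~u₂ , u₁≁L) , (_ , path-L)) us! avoids within =
    LegalOrdering-peel u₁∉C u₁~u₂ u₁≁L us! avoids within
      (Gconf⇒LegalOrdering g path-L (Unique-tail (Unique-tail us!)))
  Gconf⇒LegalOrdering (gc-right {u₁} {init} {x} {y} y∉C g) path us! avoids within =
    LegalOrdering-resp-↭ (↭-sym rotate)
      (LegalOrdering-peel y∉C (Adj-sym x~y) (InducedPath-last L path) yxL!
        (Avoids-resp-↭ rotate avoids) (NeighboursWithin-resp-↭ rotate within)
        (Gconf⇒LegalOrdering g (InducedPath-++⁻ˡ L path) (Unique-tail (Unique-tail yxL!))))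
    where
    L = u₁ ∷ init
    rotate : L ++ x ∷ y ∷ [] ↭ y ∷ x ∷ L
    rotate = ↭-trans (++-comm L (x ∷ y ∷ [])) (↭-swap x y ↭-refl)
    yxL! = Unique-resp-↭ rotate us!
    x~y : Adj x y
    x~y = proj₁ (proj₁ (InducedPath-++⁻ʳ L path))

  Gconf⇒LegalDominating : ∀ {i x us} → i ∉ C → Adj i x → InducedPathAvoiding n k i us → Gconf C us →
                              ∃[ vs ] (Legal n k C vs × Dominating n k C vs × length vs ≡ 2 + length us)
  Gconf⇒LegalDominating {i} {x} {us} i∉C i~x (us! , us⇔V∖N[i] , path) gconf =
    i ∷ (O.seq ++ x ∷ []) ,
    (Unique-∷ i∉seq (Unique.++⁺ O.unique ([] ∷ []) λ { (x∈seq , here refl) → x∉us (O.⊆us x∈seq) }) ,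
     LegalFrom-++ O.seq O.legal ((i , ∈-N-adj (Adj-sym i~x) , i∉covered) , tt)) ,
    Dominating-covered i (O.seq ++ x ∷ []) all-covered ,
    cong suc (trans (length-++ O.seq) (trans (+-comm _ 1) (cong suc O.length≡)))
    where
    ∉us : ∀ {w} → w ∈ Nclosed n k i → w ∉ₗ us
    ∉us w∈N[i] w∈us = us⇔V∖N[i] _ .to w∈us w∈N[i]
    i∉us = ∉us (∈-Nclosed-self i)
    x∉us = ∉us (∈-Nclosed-adj i~x)

    avoids : Avoids (N i) us
    avoids u∈us u∈Ni with ∈-N⁻ i u∈Ni
    ... | inj₁ (_ , i∈C) = i∉C i∈C
    ... | inj₂ i~u       = ∉us (∈-Nclosed-adj i~u) u∈us

    within : NeighboursWithin (N i) us
    within {u} {w} u∈us w∈Nu with w ∈? Nclosed n k i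
    ... | no w∉N[i] = inj₂ (us⇔V∖N[i] w .from w∉N[i])
    ... | yes w∈N[i] with ∈-Nclosed⁻ i w∈N[i]
    ...   | inj₂ i~w   = inj₁ (∈-N-adj i~w)
    ...   | inj₁ refl with ∈-N⁻ u w∈Nu
    ...     | inj₁ (refl , _) = ⊥-elim (i∉us u∈us)
    ...     | inj₂ u~i        = ⊥-elim (∉us (∈-Nclosed-adj (Adj-sym u~i)) u∈us)

    module O = LegalOrdering (Gconf⇒LegalOrdering gconf (InducedPath-lookup us path) us! avoids within)

    i∉seq : i ∉ₗ O.seq ++ x ∷ []
    i∉seq i∈ with ∈-++⁻ O.seq i∈
    ... | inj₁ i∈seq = i∉us (O.⊆us i∈seq)
    ... | inj₂ (here refl) = Adj-irrefl i~x

    i∉covered : i ∉ covered (N i) O.seq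
    i∉covered i∈ = [ ∉C⇒∉N-self i∉C , i∉us ]′ (O.covered⁻ i∈)

    all-covered : ∀ w → w ∈ covered (N i) (O.seq ++ x ∷ [])
    all-covered w = subst (w ∈_) (sym (covered-++ (N i) O.seq (x ∷ []))) (x∈p∪q⁺ reached)
      where
      reached : w ∈ covered (N i) O.seq ⊎ w ∈ N x
      reached with w ∈? Nclosed n k i
      ... | no w∉N[i] = inj₁ (O.covered⁺ (us⇔V∖N[i] w .from w∉N[i]))
      ... | yes w∈N[i] with ∈-Nclosed⁻ i w∈N[i]
      ...   | inj₁ refl = inj₂ (∈-N-adj (Adj-sym i~x))
      ...   | inj₂ i~w  = inj₁ (acc⊆covered O.seq (∈-N-adj i~w))

module TightSequences (n k : ℕ) (C : Subset n) where

  open Neighbourhoods n k C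
  open Footprints n k C
  open InducedPaths n k
  open GoodConfigurations n k C

  Exhausted : Subset n → Fin n → Set
  Exhausted acc w = w ∉ C × (∀ {u} → Adj w u → u ∈ acc)

  Tight-¬TwoNeighbours : ∀ {acc v vs} → LegalFrom n k C acc (v ∷ vs) → Tight acc (v ∷ vs) →
                         ¬ TwoNeighbours (_∉ acc) v
  Tight-¬TwoNeighbours legal tight (a , b , a≢b , a∉ , b∉ , v~a , v~b) =
    a≢b (Tight-new-unique legal tight (∈-N-adj v~a) (∈-N-adj v~b) a∉ b∉)

  Tight-¬self-and-neighbour : ∀ {acc v vs a} → LegalFrom n k C acc (v ∷ vs) → Tight acc (v ∷ vs) →
                              v ∈ C → v ∉ acc → Adj v a → a ∉ acc → ⊥
  Tight-¬self-and-neighbour legal tight v∈C v∉acc v~a a∉acc =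
    Adj-irrefl (subst (Adj _) (sym (Tight-new-unique legal tight (∈-N-self v∈C) (∈-N-adj v~a) v∉acc a∉acc)) v~a)

  Tight-first∈ : ∀ {acc us v vs} → (∀ w → w ∈ acc ⊎ w ∈ₗ us ⊎ Exhausted acc w) →
                 (∀ {w} → w ∈ acc → TwoNeighbours (_∉ acc) w) →
                 LegalFrom n k C acc (v ∷ vs) → Tight acc (v ∷ vs) → v ∈ₗ us
  Tight-first∈ {v = v} classify branching legal tight with classify v
  ... | inj₁ v∈acc       = ⊥-elim (Tight-¬TwoNeighbours legal tight (branching v∈acc))
  ... | inj₂ (inj₁ v∈us) = v∈us
  ... | inj₂ (inj₂ (v∉C , exhausted)) with proj₁ legal
  ...   | w , w∈Nv , w∉acc with ∈-N⁻ v w∈Nv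
  ...     | inj₁ (_ , v∈C) = ⊥-elim (v∉C v∈C)
  ...     | inj₂ v~w       = ⊥-elim (w∉acc (exhausted v~w))

  -- The vertices still to be footprinted form the induced path us; everything else is
  -- either footprinted already (and would footprint two more if played) or can never be played.
  record Residue (acc : Subset n) (us : List (Fin n)) : Set where
    field
      classify     : ∀ w → w ∈ acc ⊎ w ∈ₗ us ⊎ Exhausted acc w
      unique       : Unique us
      path         : InducedPath us
      avoids       : Avoids acc us
      branching    : ∀ {w} → w ∈ acc → TwoNeighbours (_∉ acc) w
      reaches-ends : ∀ {w u} → w ∈ acc → u ∈ₗ us → Adj w u → ¬ Inner us u

  Residue-peel : ∀ {acc us e x L} → Residue acc us → us ↭ e ∷ x ∷ L → e ∉ C → Adj e x → All (NonAdj e) L →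
                 InducedPath L → Inner us x → (∀ {u} → u ∈ₗ L → Adj x u → ¬ Inner L u) →
                 Residue (acc ∪ N e) L
  Residue-peel {acc} {us} {e} {x} {L} R us↭ e∉C e~x e≁L path-L x-inner x-ends = record
    { classify = classify′ ; unique = Unique-tail (Unique-tail e∷x∷L!) ; path = path-L
    ; avoids = avoids′ ; branching = branching′ ; reaches-ends = reaches-ends′ }
    where
    module R = Residue R
    e∷x∷L! = Unique-resp-↭ us↭ R.unique
    ∈us : ∀ {u} → u ∈ₗ e ∷ x ∷ L → u ∈ₗ us
    ∈us = ∈-resp-↭ (↭-sym us↭)
    e∉acc = R.avoids (∈us (here refl))

    footprint-of-e : ∀ {u} → u ∈ N e → u ∉ acc → u ≡ x
    footprint-of-e u∈Ne u∉acc with ∈-N⁻ e u∈Ne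
    ... | inj₁ (_ , e∈C) = ⊥-elim (e∉C e∈C)
    ... | inj₂ e~u with R.classify _
    ...   | inj₁ u∈acc                  = ⊥-elim (u∉acc u∈acc)
    ...   | inj₂ (inj₂ (_ , exhausted)) = ⊥-elim (e∉acc (exhausted (Adj-sym e~u)))
    ...   | inj₂ (inj₁ u∈us) with ∈-resp-↭ us↭ u∈us
    ...     | here refl         = ⊥-elim (Adj-irrefl e~u)
    ...     | there (here refl) = refl
    ...     | there (there u∈L) = ⊥-elim (All.lookup e≁L u∈L e~u)

    fresh : ∀ {u} → u ∉ acc → u ≢ x → u ∉ acc ∪ N e
    fresh u∉acc u≢x u∈ = [ u∉acc , (λ u∈Ne → u≢x (footprint-of-e u∈Ne u∉acc)) ]′ (x∈p∪q⁻ acc (N e) u∈)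

    classify′ : ∀ w → w ∈ acc ∪ N e ⊎ w ∈ₗ L ⊎ Exhausted (acc ∪ N e) w
    classify′ w with R.classify w
    ... | inj₁ w∈acc                    = inj₁ (x∈p∪q⁺ (inj₁ w∈acc))
    ... | inj₂ (inj₂ (w∉C , exhausted)) = inj₂ (inj₂ (w∉C , x∈p∪q⁺ ∘ inj₁ ∘ exhausted))
    ... | inj₂ (inj₁ w∈us) with ∈-resp-↭ us↭ w∈us
    ...   | here refl         = inj₂ (inj₂ (e∉C , x∈p∪q⁺ ∘ inj₂ ∘ ∈-N-adj))
    ...   | there (here refl) = inj₁ (x∈p∪q⁺ (inj₂ (∈-N-adj e~x)))
    ...   | there (there w∈L) = inj₂ (inj₁ w∈L)

    avoids′ : Avoids (acc ∪ N e) L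
    avoids′ u∈L = fresh (R.avoids (∈us (there (there u∈L)))) λ { refl → Unique-head (Unique-tail e∷x∷L!) u∈L }

    footprinted-by-e : ∀ {w} → w ∈ acc ∪ N e → w ∉ acc → w ≡ x
    footprinted-by-e w∈ w∉acc = [ ⊥-elim ∘ w∉acc , (λ w∈Ne → footprint-of-e w∈Ne w∉acc) ]′ (x∈p∪q⁻ acc (N e) w∈)

    branching′ : ∀ {w} → w ∈ acc ∪ N e → TwoNeighbours (_∉ acc ∪ N e) w
    branching′ {w} w∈ with w ∈? acc
    ... | yes w∈acc = TwoNeighbours-map
      (λ w~u u∉acc → fresh u∉acc λ { refl → R.reaches-ends w∈acc (∈us (there (here refl))) w~u x-inner })
      (R.branching w∈acc)
    ... | no w∉acc with footprinted-by-e w∈ w∉acc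
    ...   | refl = TwoNeighbours-map (λ x~u u∈us → fresh (R.avoids u∈us) λ { refl → Adj-irrefl x~u }) x-inner

    reaches-ends′ : ∀ {w u} → w ∈ acc ∪ N e → u ∈ₗ L → Adj w u → ¬ Inner L u
    reaches-ends′ {w} w∈ u∈L w~u L-inner with w ∈? acc
    ... | yes w∈acc =
      R.reaches-ends w∈acc (∈us (there (there u∈L))) w~u (TwoNeighbours-map (λ _ → ∈us ∘ there ∘ there) L-inner)
    ... | no w∉acc with footprinted-by-e w∈ w∉acc
    ...   | refl = x-ends u∈L w~u L-inner

  Residue-peel-head : ∀ {acc e x y rest} → Residue acc (e ∷ x ∷ y ∷ rest) → e ∉ C → Residue (acc ∪ N e) (y ∷ rest)
  Residue-peel-head {e = e} {x} {y} {rest} R e∉C =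
    Residue-peel R ↭-refl e∉C e~x e≁L path-L x-inner x-ends
    where
    module R = Residue R
    e~x = proj₁ (proj₁ R.path)
    e≁L = proj₂ (proj₁ R.path)
    x~y = proj₁ (proj₁ (proj₂ R.path))
    x≁rest = proj₂ (proj₁ (proj₂ R.path))
    path-L = proj₂ (proj₂ R.path)
    x-inner : Inner (e ∷ x ∷ y ∷ rest) x
    x-inner = e , y , (λ e≡y → Unique-head R.unique (there (here e≡y))) ,
              here refl , there (there (here refl)) , Adj-sym e~x , x~y
    x-ends : ∀ {u} → u ∈ₗ y ∷ rest → Adj x u → ¬ Inner (y ∷ rest) u
    x-ends (here refl)  _   = head-not-inner path-L
    x-ends (there u∈rest) x~u = ⊥-elim (All.lookup x≁rest u∈rest x~u)

  Residue-peel-last : ∀ {acc L x e} → Residue acc (L ++ x ∷ e ∷ []) → L ≢ [] → e ∉ C → Residue (acc ∪ N e) L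
  Residue-peel-last {L = L} {x} {e} R L≢[] e∉C with initLast L
  ... | []          = ⊥-elim (L≢[] refl)
  ... | L′ ∷ʳ′ y    = Residue-peel R rotate e∉C (Adj-sym x~e) (InducedPath-last L R.path) (InducedPath-++⁻ˡ L R.path)
                        x-inner x-ends
    where
    module R = Residue R
    us≡ : (L′ ++ y ∷ []) ++ x ∷ e ∷ [] ≡ L′ ++ y ∷ x ∷ e ∷ []
    us≡ = ++-assoc L′ (y ∷ []) (x ∷ e ∷ [])
    path′ : InducedPath (L′ ++ y ∷ x ∷ e ∷ [])
    path′ = subst InducedPath us≡ R.path
    y~x : Adj y x
    y~x = proj₁ (proj₁ (InducedPath-++⁻ʳ L′ path′))
    x~e : Adj x e
    x~e = proj₁ (proj₁ (proj₂ (InducedPath-++⁻ʳ L′ path′)))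
    rotate : L ++ x ∷ e ∷ [] ↭ e ∷ x ∷ L
    rotate = ↭-trans (++-comm L (x ∷ e ∷ [])) (↭-swap x e ↭-refl)
    e≢y : e ≢ y
    e≢y e≡y = Unique-head (Unique-resp-↭ rotate R.unique) (there (∈-++⁺ʳ L′ (here e≡y)))
    x-inner : Inner (L ++ x ∷ e ∷ []) x
    x-inner = e , y , e≢y , ∈-++⁺ʳ L (there (here refl)) , ∈-++⁺ˡ (∈-++⁺ʳ L′ (here refl)) , x~e , Adj-sym y~x
    x≁L′ : All (NonAdj x) L′
    x≁L′ = InducedPath-last L′
      (InducedPath-++⁻ˡ (L′ ++ y ∷ x ∷ []) (subst InducedPath (sym (++-assoc L′ (y ∷ x ∷ []) (e ∷ []))) path′))
    x-ends : ∀ {u} → u ∈ₗ L → Adj x u → ¬ Inner L u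
    x-ends u∈L x~u with ∈-++⁻ L′ u∈L
    ... | inj₁ u∈L′      = ⊥-elim (All.lookup x≁L′ u∈L′ x~u)
    ... | inj₂ (here refl) = last-not-inner L′ (InducedPath-++⁻ˡ L R.path)

  Residue-singleton : ∀ {acc u v vs} → Residue acc (u ∷ []) → LegalFrom n k C acc (v ∷ vs) → Tight acc (v ∷ vs) →
                      u ∈ C
  Residue-singleton {u = u} R legal tight with Tight-first∈ (Residue.classify R) (Residue.branching R) legal tight
  ... | here refl with proj₁ legal
  ...   | w , w∈Nu , w∉acc with ∈-N⁻ u w∈Nu
  ...     | inj₁ (_ , u∈C) = u∈C
  ...     | inj₂ u~w with Residue.classify R w
  ...       | inj₁ w∈acc                  = ⊥-elim (w∉acc w∈acc)
  ...       | inj₂ (inj₁ (here refl))     = ⊥-elim (Adj-irrefl u~w)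
  ...       | inj₂ (inj₂ (_ , exhausted)) = ⊥-elim (Residue.avoids R (here refl) (exhausted (Adj-sym u~w)))

  Residue-pair : ∀ {acc u₁ u₂ v vs} → Residue acc (u₁ ∷ u₂ ∷ []) → LegalFrom n k C acc (v ∷ vs) → Tight acc (v ∷ vs) →
                 ¬ (u₁ ∈ C × u₂ ∈ C)
  Residue-pair {u₁ = u₁} {u₂} {v} R legal tight (u₁∈C , u₂∈C) =
    played (Tight-first∈ R.classify R.branching legal tight)
    where
    module R = Residue R
    u₁~u₂ = proj₁ (proj₁ R.path)
    played : v ∈ₗ u₁ ∷ u₂ ∷ [] → ⊥
    played (here refl) =
      Tight-¬self-and-neighbour legal tight u₁∈C (R.avoids (here refl)) u₁~u₂ (R.avoids (there (here refl)))
    played (there (here refl)) =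
      Tight-¬self-and-neighbour legal tight u₂∈C (R.avoids (there (here refl))) (Adj-sym u₁~u₂) (R.avoids (here refl))

  -- The first vertex played is an end e of the path, or else it would footprint both of its path
  -- neighbours; if e ∉ C it footprints only its neighbour, and the rest of the path is again a residue.
  Residue⇒Gconf : ∀ {acc us} rs → Residue acc us → us ≢ [] → LegalFrom n k C acc rs → Tight acc rs → Gconf C us
  Residue⇒Gconf {us = []}    _  _ us≢[] _ _     = ⊥-elim (us≢[] refl)
  Residue⇒Gconf {us = _ ∷ _} [] R _     _ tight = ⊥-elim (<⇒≱ (∣p∣<n _ (Residue.avoids R (here refl))) tight)
  Residue⇒Gconf {us = u ∷ []}          (v ∷ rs) R _ legal tight = gc-one (Residue-singleton R legal tight)
  Residue⇒Gconf {us = u₁ ∷ u₂ ∷ []}     (v ∷ rs) R _ legal tight = gc-two (Residue-pair R legal tight)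
  Residue⇒Gconf {acc} {u₁ ∷ u₂ ∷ u₃ ∷ rest} (v ∷ rs) R _ legal tight
    with position (Residue.path R) (Residue.unique R)
                  (Tight-first∈ (Residue.classify R) (Residue.branching R) legal tight)
  ... | inj₁ (_ , refl) = case u₁ ∈? C of λ
    { (yes u₁∈C) → ⊥-elim (Tight-¬self-and-neighbour legal tight u₁∈C (Residue.avoids R (here refl))
                             (proj₁ (proj₁ (Residue.path R))) (Residue.avoids R (there (here refl))))
    ; (no u₁∉C)  → gc-left u₁∉C
                     (Residue⇒Gconf rs (Residue-peel-head R u₁∉C) (λ ()) (proj₂ legal) (Tight-∷ legal tight)) }
  ... | inj₂ (inj₂ inner) =
    ⊥-elim (Tight-¬TwoNeighbours legal tight (TwoNeighbours-map (λ _ → Residue.avoids R) inner))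
  ... | inj₂ (inj₁ (w ∷ init , x , us≡)) = case v ∈? C of λ
    { (yes v∈C) → ⊥-elim (Tight-¬self-and-neighbour legal tight v∈C (R′.avoids v∈) (Adj-sym x~v) (R′.avoids x∈))
    ; (no v∉C)  → subst (Gconf C) (sym us≡) (gc-right v∉C
                    (Residue⇒Gconf rs (Residue-peel-last R′ (λ ()) v∉C) (λ ()) (proj₂ legal) (Tight-∷ legal tight))) }
    where
    R′ = subst (Residue acc) us≡ R
    module R′ = Residue R′
    x~v = proj₁ (proj₁ (InducedPath-++⁻ʳ (w ∷ init) R′.path))
    v∈ = ∈-++⁺ʳ (w ∷ init) (there (here refl))
    x∈ = ∈-++⁺ʳ (w ∷ init) (here refl)

-- The web with n = 2k + 1 + t

module Web (k t : ℕ) (C : Subset (suc (k + k + t))) where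

  n : ℕ
  n = suc (k + k + t)

  open Neighbourhoods n k C public
  open Cyclic n k public
  open Footprints n k C public
  open InducedPaths n k public
  open GoodConfigurations n k C public

  n∸k≡1+k+t : n ∸ k ≡ suc (k + t)
  n∸k≡1+k+t = begin
    suc (k + k + t) ∸ k  ≡⟨ +-∸-assoc 1 (≤-trans (m≤m+n k k) (m≤m+n (k + k) t)) ⟩
    suc (k + k + t ∸ k)  ≡⟨ cong (λ m → suc (m ∸ k)) (+-assoc k k t) ⟩
    suc (k + (k + t) ∸ k) ≡⟨ cong suc (m+n∸m≡n k (k + t)) ⟩
    suc (k + t)          ∎
    where open ≡-Reasoning

  1+k+t+k≡n : suc (k + t) + k ≡ n
  1+k+t+k≡n = cong suc (trans (+-comm (k + t) k) (sym (+-assoc k k t)))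

  k<n : k < n
  k<n = s≤s (≤-trans (m≤m+n k k) (m≤m+n (k + k) t))

  Close-offsets : List ℕ
  Close-offsets = range 1 k ++ range (suc (k + t)) k

  Close⇔∈-offsets : ∀ {x} → x < n → Close x ⇔ x ∈ₗ Close-offsets
  Close⇔∈-offsets {x} x<n = mk⇔
    (λ { (1≤x , inj₁ x≤k)   → ∈-++⁺ˡ (∈-range⁺ 1 k 1≤x (s≤s x≤k))
       ; (1≤x , inj₂ n∸k≤x) → ∈-++⁺ʳ (range 1 k)
           (∈-range⁺ (suc (k + t)) k (subst (_≤ x) n∸k≡1+k+t n∸k≤x) (subst (x <_) (sym 1+k+t+k≡n) x<n)) })
    (λ x∈ → case ∈-++⁻ (range 1 k) x∈ of λ
      { (inj₁ x∈low)  → let 1≤x , x<1+k = ∈-range⁻ 1 k x∈low in 1≤x , inj₁ (s≤s⁻¹ x<1+k)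
      ; (inj₂ x∈high) → let k+t<x , _ = ∈-range⁻ (suc (k + t)) k x∈high in
          ≤-trans (s≤s z≤n) k+t<x , inj₂ (subst (_≤ x) (sym n∸k≡1+k+t) k+t<x) })

  Close-offsets-bounded : Bounded Close-offsets
  Close-offsets-bounded {x} x∈ with ∈-++⁻ (range 1 k) x∈
  ... | inj₁ x∈low  = ≤-<-trans (s≤s⁻¹ (proj₂ (∈-range⁻ 1 k x∈low))) k<n
  ... | inj₂ x∈high = subst (x <_) 1+k+t+k≡n (proj₂ (∈-range⁻ (suc (k + t)) k x∈high))

  Close-offsets-unique : Unique Close-offsets
  Close-offsets-unique = Unique.++⁺ (range-unique 1 k) (range-unique (suc (k + t)) k)
    λ (x∈low , x∈high) → <⇒≱ (proj₂ (∈-range⁻ 1 k x∈low))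
                              (≤-trans (s≤s (m≤m+n k t)) (proj₁ (∈-range⁻ (suc (k + t)) k x∈high)))

  length-Close-offsets : length Close-offsets ≡ k + k
  length-Close-offsets = trans (length-++ (range 1 k)) (cong₂ _+_ (length-range 1 k) (length-range (suc (k + t)) k))

  ∈-N⇔⊖ : ∀ v w → w ∈ N v ⇔ ((w ⊖ v ≡ 0 × v ∈ C) ⊎ Close (w ⊖ v))
  ∈-N⇔⊖ v w = mk⇔
    (Sum.map (λ { (refl , v∈C) → ⊖-self v , v∈C }) (Adj⇔Close-⊖ v w .to) ∘ ∈-N⁻ v)
    [ (λ (w⊖v≡0 , v∈C) → subst (_∈ N v) (sym (⊖≡0⇒≡ w⊖v≡0)) (∈-N-self v∈C)) , ∈-N-adj ∘ Adj⇔Close-⊖ v w .from ]′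

  ∈-N⇔Close : ∀ {v w} → v ∉ C → w ∈ N v ⇔ Close (w ⊖ v)
  ∈-N⇔Close {v} {w} v∉C = mk⇔ [ (λ (_ , v∈C) → ⊥-elim (v∉C v∈C)) , id ]′ inj₂ ⇔-∘ ∈-N⇔⊖ v w

  ∣N∣≡length : ∀ v {xs} → Bounded xs → Unique xs →
               (∀ {x} → x < n → ((x ≡ 0 × v ∈ C) ⊎ Close x) ⇔ x ∈ₗ xs) → ∣ N v ∣ ≡ length xs
  ∣N∣≡length v {xs} bounded xs! offsets = trans
    (∣p∣≡length (N v) (Unique-map-⊕ v bounded xs!)
      (λ {w} → ⇔-sym (∈-map-⊕ v bounded) ⇔-∘ (offsets (⊖<n w v) ⇔-∘ ∈-N⇔⊖ v w)))
    (length-map (v ⊕_) xs)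

  ∣N∣-∉C : ∀ {v} → v ∉ C → ∣ N v ∣ ≡ k + k
  ∣N∣-∉C {v} v∉C = trans (∣N∣≡length v Close-offsets-bounded Close-offsets-unique offsets) length-Close-offsets
    where
    offsets : ∀ {x} → x < n → ((x ≡ 0 × v ∈ C) ⊎ Close x) ⇔ x ∈ₗ Close-offsets
    offsets x<n = Close⇔∈-offsets x<n ⇔-∘ mk⇔ [ (λ (_ , v∈C) → ⊥-elim (v∉C v∈C)) , id ]′ inj₂

  ∣N∣-∈C : ∀ {v} → v ∈ C → ∣ N v ∣ ≡ suc (k + k)
  ∣N∣-∈C {v} v∈C = trans (∣N∣≡length v bounded unique offsets) (cong suc length-Close-offsets)
    where
    bounded : Bounded (0 ∷ Close-offsets)
    bounded (here refl) = 0<n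
    bounded (there x∈)  = Close-offsets-bounded x∈
    unique : Unique (0 ∷ Close-offsets)
    unique = Unique-∷ (λ 0∈ → 1+n≰n (proj₁ (Close⇔∈-offsets 0<n .from 0∈))) Close-offsets-unique
    offsets : ∀ {x} → x < n → ((x ≡ 0 × v ∈ C) ⊎ Close x) ⇔ x ∈ₗ 0 ∷ Close-offsets
    offsets x<n = mk⇔ [ (λ { (refl , _) → here refl }) , there ∘ Close⇔∈-offsets x<n .to ]′
                      λ { (here refl) → inj₁ (refl , v∈C) ; (there x∈) → inj₂ (Close⇔∈-offsets x<n .from x∈) }

  δ₁≡-CaseI : CaseI n C → δ₁ n k C ≡ suc (k + k)
  δ₁≡-CaseI all∈C = ≤-antisym
    (≤-trans (δ₁≤∣N∣ Fin.zero) (≤-reflexive (∣N∣-∈C (all∈C Fin.zero))))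
    (≤δ₁ (s≤s (m≤m+n (k + k) t)) (λ v → ≤-reflexive (sym (∣N∣-∈C (all∈C v)))))

  δ₁≡-∉C : ∀ {v} → v ∉ C → δ₁ n k C ≡ k + k
  δ₁≡-∉C {v} v∉C = ≤-antisym
    (≤-trans (δ₁≤∣N∣ v) (≤-reflexive (∣N∣-∉C v∉C)))
    (≤δ₁ (≤-trans (m≤m+n (k + k) t) (n≤1+n _)) 2k≤∣N∣)
    where
    2k≤∣N∣ : ∀ u → k + k ≤ ∣ N u ∣
    2k≤∣N∣ u = case u ∈? C of λ
      { (yes u∈C) → ≤-trans (n≤1+n _) (≤-reflexive (sym (∣N∣-∈C u∈C)))
      ; (no u∉C)  → ≤-reflexive (sym (∣N∣-∉C u∉C)) }

  m₁≡-CaseI : CaseI n C → m₁ n k C ≡ suc t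
  m₁≡-CaseI all∈C = begin
    n ∸ δ₁ n k C + 1          ≡⟨ cong (λ d → n ∸ d + 1) (δ₁≡-CaseI all∈C) ⟩
    k + k + t ∸ (k + k) + 1   ≡⟨ cong (_+ 1) (m+n∸m≡n (k + k) t) ⟩
    t + 1                     ≡⟨ +-comm t 1 ⟩
    suc t                     ∎
    where open ≡-Reasoning

  m₁≡-∉C : ∀ {v} → v ∉ C → m₁ n k C ≡ suc (suc t)
  m₁≡-∉C v∉C = begin
    n ∸ δ₁ n k C + 1          ≡⟨ cong (λ d → n ∸ d + 1) (δ₁≡-∉C v∉C) ⟩
    n ∸ (k + k) + 1           ≡⟨ cong (_+ 1) (+-∸-assoc 1 (m≤m+n (k + k) t)) ⟩
    suc (k + k + t ∸ (k + k)) + 1 ≡⟨ cong (λ m → suc m + 1) (m+n∸m≡n (k + k) t) ⟩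
    suc t + 1                 ≡⟨ +-comm (suc t) 1 ⟩
    suc (suc t)               ∎
    where open ≡-Reasoning

  n∸[2k+1]≡t : n ∸ (2 * k + 1) ≡ t
  n∸[2k+1]≡t = trans (cong (n ∸_) (trans (+-comm (2 * k) 1) (cong (λ m → suc (k + m)) (+-identityʳ k))))
                     (m+n∸m≡n (suc (k + k)) t)

  Adj-⊕1 : 1 ≤ k → ∀ v → Adj v (v ⊕ 1)
  Adj-⊕1 1≤k v = subst (λ u → Adj u (v ⊕ 1)) (⊕-zero v) (Adj-⊕⇔~ v 0<n 1<n .from (≤-refl , inj₁ 1≤k))
    where
    1<n : 1 < n
    1<n = s≤s (≤-trans 1≤k (≤-trans (m≤m+n k k) (m≤m+n (k + k) t)))

  t<n : t < n
  t<n = s≤s (m≤n+m t (k + k))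

  t+k<n : t + k < n
  t+k<n = s≤s (≤-trans (≤-reflexive (+-comm t k)) (+-monoˡ-≤ t (m≤m+n k k)))

  ∈-N-⊕⁻ : ∀ h {a w} → a < n → w ∈ N (h ⊕ a) → w ⊖ h ≤ a + k ⊎ n ∸ k ≤ w ⊖ h
  ∈-N-⊕⁻ h {a} {w} a<n w∈ with ∈-N⁻ (h ⊕ a) w∈ | ≤-total (w ⊖ h) a
  ... | inj₁ (refl , _) | _       = inj₁ (≤-trans (≤-reflexive (⊖-⊕ h a<n)) (m≤m+n a k))
  ... | inj₂ _          | inj₁ x≤a = inj₁ (≤-trans x≤a (m≤m+n a k))
  ... | inj₂ a~         | inj₂ a≤x
    with proj₂ (subst Close (m≤n⇒∣m-n∣≡n∸m a≤x) (subst (_~ w ⊖ h) (⊖-⊕ h a<n) (Adj⇔~-⊖ h (h ⊕ a) w .to a~)))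
  ...   | inj₁ x∸a≤k = inj₁ (≤-trans (≤-reflexive (sym (m+[n∸m]≡n a≤x))) (+-monoʳ-≤ a x∸a≤k))
  ...   | inj₂ n∸k≤x∸a = inj₂ (≤-trans n∸k≤x∸a (m∸n≤m (w ⊖ h) a))

  module _ (1≤k : 1 ≤ k) (1≤t : 1 ≤ t) (h : Fin n) where

    arc : List (Fin n)
    arc = map (h ⊕_) (range 0 (suc t))

    private
      CoveredBelow : ℕ → Subset n → Set
      CoveredBelow a acc = ∀ {w} → w ∈ acc → w ⊖ h < a + k ⊎ n ∸ k ≤ w ⊖ h

      -- h ⊕ a footprints h ⊕ (a + k), which no earlier vertex reaches.
      LegalFrom-arc : ∀ a s {acc} → a + s ≤ suc t → CoveredBelow a acc →
                         LegalFrom n k C acc (map (h ⊕_) (range a s))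
      LegalFrom-arc a zero    _    _     = tt
      LegalFrom-arc a (suc s) {acc} a+s≤ below =
        (h ⊕ (a + k) , ∈-N-adj a~a+k , fresh) ,
        LegalFrom-arc (suc a) s (subst (_≤ suc t) (+-suc a s) a+s≤) below′
        where
        a≤t : a ≤ t
        a≤t = s≤s⁻¹ (≤-trans (s≤s (m≤m+n a s)) (subst (_≤ suc t) (+-suc a s) a+s≤))
        a+k<n : a + k < n
        a+k<n = ≤-<-trans (+-monoˡ-≤ k a≤t) t+k<n
        a<n : a < n
        a<n = ≤-<-trans a≤t t<n
        a~a+k : Adj (h ⊕ a) (h ⊕ (a + k))
        a~a+k = Adj-⊕⇔~ h a<n a+k<n .from (subst Close (sym (∣m-m+n∣≡n a k)) (1≤k , inj₁ ≤-refl))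
        fresh : h ⊕ (a + k) ∉ acc
        fresh a+k∈ with below a+k∈
        ... | inj₁ a+k<a+k = <-irrefl (⊖-⊕ h a+k<n) a+k<a+k
        ... | inj₂ n∸k≤a+k = 1+n≰n (begin
          suc (k + t)   ≡⟨ sym n∸k≡1+k+t ⟩
          n ∸ k         ≤⟨ n∸k≤a+k ⟩
          (h ⊕ (a + k)) ⊖ h ≡⟨ ⊖-⊕ h a+k<n ⟩
          a + k         ≤⟨ +-monoˡ-≤ k a≤t ⟩
          t + k         ≡⟨ +-comm t k ⟩
          k + t         ∎)
          where open ≤-Reasoning
        below′ : CoveredBelow (suc a) (acc ∪ N (h ⊕ a))
        below′ w∈ with x∈p∪q⁻ acc (N (h ⊕ a)) w∈
        ... | inj₁ w∈acc = Sum.map₁ (λ lt → ≤-trans lt (n≤1+n _)) (below w∈acc)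
        ... | inj₂ w∈N   = Sum.map₁ s≤s (∈-N-⊕⁻ h a<n w∈N)

    arc-legal : Legal n k C arc
    arc-legal =
      Unique-map-⊕ h (λ x∈ → ≤-<-trans (s≤s⁻¹ (proj₂ (∈-range⁻ 0 (suc t) x∈))) t<n) (range-unique 0 (suc t)) ,
      LegalFrom-arc 1 t ≤-refl (Sum.map₁ s≤s ∘ ∈-N-⊕⁻ h 0<n)

    length-arc : length arc ≡ suc t
    length-arc = trans (length-map (h ⊕_) (range 0 (suc t))) (length-range 0 (suc t))

    arc-dominating : Dominating n k C arc
    arc-dominating = Dominating-covered (h ⊕ 0) (map (h ⊕_) (range 1 t))
      λ w → subst (_∈ covered (N (h ⊕ 0)) (map (h ⊕_) (range 1 t))) (⊕-⊖ h w) (reached (w ⊖ h) (⊖<n w h))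
      where
      reached-via : ∀ {j x} → j ≤ t → x < n → Close ∣ j - x ∣ →
                    h ⊕ x ∈ covered (N (h ⊕ 0)) (map (h ⊕_) (range 1 t))
      reached-via j≤t x<n close =
        N⊆covered-∷ (map (h ⊕_) (range 1 t)) (∈-map⁺ (h ⊕_) (∈-range⁺ 0 (suc t) z≤n (s≤s j≤t)))
          (∈-N-adj (Adj-⊕⇔~ h (≤-<-trans j≤t t<n) x<n .from close))
      reached : ∀ x → x < n → h ⊕ x ∈ covered (N (h ⊕ 0)) (map (h ⊕_) (range 1 t))
      reached zero    _   = reached-via 1≤t 0<n (≤-refl , inj₁ 1≤k)
      reached (suc x) x<n with suc x ≤? t
      ... | yes 1+x≤t = reached-via (≤-trans (n≤1+n x) 1+x≤t) x<n
                          (subst Close (sym (∣n-1+n∣≡1 x)) (≤-refl , inj₁ 1≤k))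
      ... | no 1+x≰t with suc x ≤? t + k
      ...   | yes 1+x≤t+k = reached-via ≤-refl x<n (subst Close (sym (m≤n⇒∣m-n∣≡n∸m (<⇒≤ (≰⇒> 1+x≰t))))
                              (m<n⇒0<n∸m (≰⇒> 1+x≰t) , inj₁ (m≤n+o⇒m∸n≤o (suc x) t 1+x≤t+k)))
      ...   | no 1+x≰t+k = reached-via z≤n x<n
                             (s≤s z≤n , inj₂ (subst (_≤ suc x) (sym n∸k≡1+k+t)
                                               (subst (_< suc x) (+-comm t k) (≰⇒> 1+x≰t+k))))

module FarSide (k t : ℕ) (C : Subset (suc (k + k + t))) where

  open Web k t C
  open TightSequences n k C

  FarOffset : ℕ → Set
  FarOffset x = suc k ≤ x × x < suc k + t

  far-offset<n : ∀ {x} → FarOffset x → x < n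
  far-offset<n (_ , x<1+k+t) = ≤-trans x<1+k+t (s≤s (+-monoˡ-≤ t (m≤m+n k k)))

  far-offset-¬Close : ∀ {x} → FarOffset x → ¬ Close x
  far-offset-¬Close (k<x , _)     (_ , inj₁ x≤k)   = 1+n≰n (≤-trans k<x x≤k)
  far-offset-¬Close {x} (_ , x<1+k+t) (_ , inj₂ n∸k≤x) = 1+n≰n (≤-trans x<1+k+t (subst (_≤ x) n∸k≡1+k+t n∸k≤x))

  offset-trichotomy : ∀ {x} → x < n → x ≡ 0 ⊎ Close x ⊎ FarOffset x
  offset-trichotomy {zero}  _ = inj₁ refl
  offset-trichotomy {suc x} x<n with suc x ≤? k | suc x <? suc k + t
  ... | yes 1+x≤k | _ = inj₂ (inj₁ (s≤s z≤n , inj₁ 1+x≤k))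
  ... | no 1+x≰k  | yes x<1+k+t = inj₂ (inj₂ (≰⇒> 1+x≰k , x<1+k+t))
  ... | no _      | no x≮1+k+t = inj₂ (inj₁ (s≤s z≤n , inj₂ (subst (_≤ suc x) (sym n∸k≡1+k+t) (≮⇒≥ x≮1+k+t))))

  -- Exactly the cases in which the far side of a vertex induces a path.
  PathCase : Set
  PathCase = k ≡ 1 ⊎ t ≤ 2

  private
    far-distance-ordered : ∀ {a b} → FarOffset a → FarOffset b → a ≤ b → b ∸ a < t
    far-distance-ordered {a} {b} (k<a , _) (_ , b<1+k+t) a≤b = begin-strict
      b ∸ a                ≤⟨ ∸-monoʳ-≤ b k<a ⟩
      b ∸ suc k            <⟨ ∸-monoˡ-< b<1+k+t (≤-trans k<a a≤b) ⟩
      suc k + t ∸ suc k    ≡⟨ m+n∸m≡n (suc k) t ⟩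
      t                    ∎
      where open ≤-Reasoning

  far-distance<t : ∀ {a b} → FarOffset a → FarOffset b → ∣ a - b ∣ < t
  far-distance<t {a} {b} a-far b-far with ≤-total a b
  ... | inj₁ a≤b = subst (_< t) (sym (m≤n⇒∣m-n∣≡n∸m a≤b)) (far-distance-ordered a-far b-far a≤b)
  ... | inj₂ b≤a = subst (_< t) (sym (m≤n⇒∣n-m∣≡n∸m b≤a)) (far-distance-ordered b-far a-far b≤a)

  Close⇔≡1 : 1 ≤ k → PathCase → ∀ {d} → d < t → Close d ⇔ d ≡ 1
  Close⇔≡1 1≤k path-case {d} d<t =
    mk⇔ (λ (1≤d , near) → ≤-antisym (d≤1 path-case near) 1≤d) (λ { refl → ≤-refl , inj₁ 1≤k })
    where
    d≤1 : PathCase → d ≤ k ⊎ n ∸ k ≤ d → d ≤ 1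
    d≤1 _           (inj₂ n∸k≤d) = ⊥-elim (1+n≰n (≤-trans d<t (≤-trans (≤-trans (m≤n+m t k) (n≤1+n _))
                                     (subst (_≤ d) n∸k≡1+k+t n∸k≤d))))
    d≤1 (inj₁ k≡1) (inj₁ d≤k)    = subst (d ≤_) k≡1 d≤k
    d≤1 (inj₂ t≤2) (inj₁ _)      = s≤s⁻¹ (≤-trans d<t t≤2)

  near-far-Close : ∀ {x a} → x < n → Close x → FarOffset a → Close ∣ x - a ∣ → a ≤ k + k ⊎ suc t ≤ a
  near-far-Close {x} {a} _ (_ , inj₁ x≤k) (k<a , _) (_ , inj₁ d≤k) = inj₁ (begin
    a              ≡⟨ sym (m+[n∸m]≡n x≤a) ⟩
    x + (a ∸ x)    ≤⟨ +-mono-≤ x≤k (subst (_≤ k) (m≤n⇒∣m-n∣≡n∸m x≤a) d≤k) ⟩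
    k + k          ∎)
    where
    open ≤-Reasoning
    x≤a = ≤-trans x≤k (<⇒≤ k<a)
  near-far-Close {x} {a} _ (_ , inj₁ x≤k) (k<a , a<1+k+t) (_ , inj₂ n∸k≤d) = ⊥-elim (1+n≰n (begin
    suc (k + t)    ≡⟨ sym n∸k≡1+k+t ⟩
    n ∸ k          ≤⟨ subst (n ∸ k ≤_) (m≤n⇒∣m-n∣≡n∸m (≤-trans x≤k (<⇒≤ k<a))) n∸k≤d ⟩
    a ∸ x          ≤⟨ m∸n≤m a x ⟩
    a              ≤⟨ s≤s⁻¹ a<1+k+t ⟩
    k + t          ∎))
    where open ≤-Reasoning
  near-far-Close {x} {a} _ (_ , inj₂ n∸k≤x) (_ , a<1+k+t) (_ , inj₁ d≤k) = inj₂ (+-cancelʳ-≤ k (suc t) a (begin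
    suc t + k      ≡⟨ cong suc (+-comm t k) ⟩
    suc (k + t)    ≡⟨ sym n∸k≡1+k+t ⟩
    n ∸ k          ≤⟨ n∸k≤x ⟩
    x              ≡⟨ sym (m+[n∸m]≡n a≤x) ⟩
    a + (x ∸ a)    ≤⟨ +-monoʳ-≤ a (subst (_≤ k) (m≤n⇒∣n-m∣≡n∸m a≤x) d≤k) ⟩
    a + k          ∎))
    where
    open ≤-Reasoning
    a≤x = ≤-trans (<⇒≤ a<1+k+t) (subst (_≤ x) n∸k≡1+k+t n∸k≤x)
  near-far-Close {x} {a} x<n (_ , inj₂ n∸k≤x) (k<a , a<1+k+t) (_ , inj₂ n∸k≤d) = ⊥-elim (<⇒≱ x<n (begin
    n                ≡⟨ sym 1+k+t+k≡n ⟩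
    suc (k + t) + k  ≤⟨ +-mono-≤ (subst (_≤ x ∸ a) n∸k≡1+k+t (subst (n ∸ k ≤_) (m≤n⇒∣n-m∣≡n∸m a≤x) n∸k≤d))
                                 (≤-trans (n≤1+n k) k<a) ⟩
    x ∸ a + a        ≡⟨ m∸n+n≡m a≤x ⟩
    x                ∎))
    where
    open ≤-Reasoning
    a≤x = ≤-trans (<⇒≤ a<1+k+t) (subst (_≤ x) n∸k≡1+k+t n∸k≤x)

  far-offset-end : PathCase → ∀ {a} → FarOffset a → a ≤ k + k ⊎ suc t ≤ a → a ≡ suc k ⊎ a ≡ k + t
  far-offset-end (inj₁ k≡1) {a} (k<a , _) (inj₁ a≤k+k) =
    inj₁ (≤-antisym (subst (a ≤_) (trans (cong (λ m → m + m) k≡1) (cong suc (sym k≡1))) a≤k+k) k<a)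
  far-offset-end (inj₁ k≡1) {a} (_ , a<1+k+t) (inj₂ t<a) =
    inj₂ (≤-antisym (s≤s⁻¹ a<1+k+t) (subst (_≤ a) (cong (_+ t) (sym k≡1)) t<a))
  far-offset-end (inj₂ t≤2) {a} (k<a , a<1+k+t) _ with suc k ≟ a
  ... | yes 1+k≡a = inj₁ (sym 1+k≡a)
  ... | no 1+k≢a  = inj₂ (≤-antisym (s≤s⁻¹ a<1+k+t) (begin
    k + t          ≤⟨ +-monoʳ-≤ k t≤2 ⟩
    k + 2          ≡⟨ +-comm k 2 ⟩
    suc (suc k)    ≤⟨ ≤∧≢⇒< k<a 1+k≢a ⟩
    a              ∎))
    where open ≤-Reasoning

  first-far : 1 ≤ t → FarOffset (suc k)
  first-far 1≤t = ≤-refl , subst (_< suc k + t) (+-identityʳ (suc k)) (+-monoʳ-< (suc k) 1≤t)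

  last-far : 1 ≤ t → FarOffset (k + t)
  last-far 1≤t = subst (_≤ k + t) (+-comm k 1) (+-monoʳ-≤ k 1≤t) , ≤-refl

  near-has-far-neighbour : 1 ≤ t → ∀ {x} → x < n → Close x → ∃[ b ] (FarOffset b × Close ∣ x - b ∣)
  near-has-far-neighbour 1≤t {x} _ (1≤x , inj₁ x≤k) =
    suc k , first-far 1≤t ,
    subst (1 ≤_) (sym ∣x-1+k∣≡) (m<n⇒0<n∸m (s≤s x≤k)) , inj₁ (subst (_≤ k) (sym ∣x-1+k∣≡) (∸-monoʳ-≤ (suc k) 1≤x))
    where
    ∣x-1+k∣≡ : ∣ x - suc k ∣ ≡ suc k ∸ x
    ∣x-1+k∣≡ = m≤n⇒∣m-n∣≡n∸m (≤-trans x≤k (n≤1+n k))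
  near-has-far-neighbour 1≤t {x} x<n (_ , inj₂ n∸k≤x) =
    k + t , last-far 1≤t ,
    subst (1 ≤_) (sym ∣x-k+t∣≡) (m<n⇒0<n∸m k+t<x) , inj₁ (subst (_≤ k) (sym ∣x-k+t∣≡) (m≤n+o⇒m∸n≤o x (k + t) x≤k+t+k))
    where
    k+t<x : k + t < x
    k+t<x = subst (_≤ x) n∸k≡1+k+t n∸k≤x
    ∣x-k+t∣≡ : ∣ x - (k + t) ∣ ≡ x ∸ (k + t)
    ∣x-k+t∣≡ = m≤n⇒∣n-m∣≡n∸m (<⇒≤ k+t<x)
    x≤k+t+k : x ≤ k + t + k
    x≤k+t+k = ≤-trans (s≤s⁻¹ x<n)
      (≤-reflexive (trans (+-assoc k k t) (trans (cong (k +_) (+-comm k t)) (sym (+-assoc k t k)))))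

  WithinTwo : ℕ → ℕ → Set
  WithinTwo a b = 1 ≤ ∣ a - b ∣ × ∣ a - b ∣ ≤ 2

  private
    within₁ : ∀ a b → ∣ a - b ∣ ≡ 1 → WithinTwo a b
    within₁ _ _ d≡1 = subst (1 ≤_) (sym d≡1) ≤-refl , subst (_≤ 2) (sym d≡1) (s≤s z≤n)

    within₂ : ∀ a b → ∣ a - b ∣ ≡ 2 → WithinTwo a b
    within₂ _ _ d≡2 = subst (1 ≤_) (sym d≡2) (s≤s z≤n) , subst (_≤ 2) (sym d≡2) ≤-refl

  two-far-offsets : 3 ≤ t → ∀ {a} → FarOffset a →
                    ∃[ b ] ∃[ c ] (b ≢ c × FarOffset b × FarOffset c × WithinTwo a b × WithinTwo a c)
  two-far-offsets 3≤t {a} (k<a , a<1+k+t) with suc (suc (suc a)) ≤? suc k + t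
  ... | yes a+3≤1+k+t =
    suc a , suc (suc a) , <⇒≢ (n<1+n (suc a)) ,
    (≤-trans k<a (n≤1+n a) , ≤-trans (n≤1+n _) a+3≤1+k+t) ,
    (≤-trans k<a (≤-trans (n≤1+n a) (n≤1+n (suc a))) , a+3≤1+k+t) ,
    within₁ a (suc a) (∣n-1+n∣≡1 a) , within₂ a (suc (suc a)) (∣n-2+n∣≡2 a)
  ... | no a+3≰1+k+t = downward a k+2≤a a<1+k+t
    where
    k+3≤k+t : suc (suc (suc k)) ≤ k + t
    k+3≤k+t = subst (_≤ k + t) (+-comm k 3) (+-monoʳ-≤ k 3≤t)
    k+2≤a : suc (suc k) ≤ a
    k+2≤a = s≤s⁻¹ (≤-trans k+3≤k+t (s≤s⁻¹ (s≤s⁻¹ (≰⇒> a+3≰1+k+t))))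
    downward : ∀ a → suc (suc k) ≤ a → a < suc k + t →
               ∃[ b ] ∃[ c ] (b ≢ c × FarOffset b × FarOffset c × WithinTwo a b × WithinTwo a c)
    downward (suc zero) (s≤s ()) _
    downward (suc (suc a″)) k+2≤a a<1+k+t with suc k ≤? a″
    ... | yes k<a″ =
      suc a″ , a″ , <⇒≢ (n<1+n a″) ∘ sym ,
      (s≤s⁻¹ k+2≤a , ≤-trans (n≤1+n _) a<1+k+t) ,
      (k<a″ , ≤-trans (≤-trans (n≤1+n _) (n≤1+n _)) a<1+k+t) ,
      within₁ (suc (suc a″)) (suc a″) (trans (∣-∣-comm (suc (suc a″)) (suc a″)) (∣n-1+n∣≡1 (suc a″))) ,
      within₂ (suc (suc a″)) a″ (trans (∣-∣-comm (suc (suc a″)) a″) (∣n-2+n∣≡2 a″))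
    ... | no k≮a″ =
      suc a″ , suc (suc (suc a″)) , <⇒≢ (≤-trans (n<1+n (suc a″)) (n≤1+n _)) ,
      (s≤s⁻¹ k+2≤a , ≤-trans (n≤1+n _) a<1+k+t) ,
      (≤-trans (n≤1+n _) (≤-trans k+2≤a (n≤1+n _)) , ≤-trans (s≤s (s≤s (s≤s (s≤s (≮⇒≥ k≮a″))))) (s≤s k+3≤k+t)) ,
      within₁ (suc (suc a″)) (suc a″) (trans (∣-∣-comm (suc (suc a″)) (suc a″)) (∣n-1+n∣≡1 (suc a″))) ,
      within₁ (suc (suc a″)) (suc (suc (suc a″))) (∣n-1+n∣≡1 (suc (suc a″)))

  module _ (1≤k : 1 ≤ k) (1≤t : 1 ≤ t) (h : Fin n) (h∉C : h ∉ C) where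

    -- V ∖ N[h], in path order.
    far-side : List (Fin n)
    far-side = map (h ⊕_) (range (suc k) t)

    ∈-far-side : ∀ {w} → w ∈ₗ far-side ⇔ FarOffset (w ⊖ h)
    ∈-far-side = mk⇔ (∈-range⁻ (suc k) t ∘ ∈-map-⊕ h bounded .to)
                     (λ (k<x , x<1+k+t) → ∈-map-⊕ h bounded .from (∈-range⁺ (suc k) t k<x x<1+k+t))
      where
      bounded : Bounded (range (suc k) t)
      bounded x∈ = far-offset<n (∈-range⁻ (suc k) t x∈)

    ⊕-∈-far-side : ∀ {b} → FarOffset b → h ⊕ b ∈ₗ far-side
    ⊕-∈-far-side (k<b , b<1+k+t) = ∈-map⁺ (h ⊕_) (∈-range⁺ (suc k) t k<b b<1+k+t)

    far-side-unique : Unique far-side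
    far-side-unique = Unique-map-⊕ h (far-offset<n ∘ ∈-range⁻ (suc k) t) (range-unique (suc k) t)

    length-far-side : length far-side ≡ t
    length-far-side = trans (length-map (h ⊕_) (range (suc k) t)) (length-range (suc k) t)

    ∈-N-root : ∀ {w} → w ∈ N h ⇔ Close (w ⊖ h)
    ∈-N-root {w} = ∈-N⇔Close {h} {w} h∉C

    far-side-avoids : Avoids (N h) far-side
    far-side-avoids u∈ u∈Nh = far-offset-¬Close (∈-far-side .to u∈) (∈-N-root .to u∈Nh)

    root-exhausted : Exhausted (N h) h
    root-exhausted = h∉C , ∈-N-adj

    classify-root : ∀ w → w ∈ N h ⊎ w ∈ₗ far-side ⊎ Exhausted (N h) w
    classify-root w with offset-trichotomy (⊖<n w h)
    ... | inj₁ w⊖h≡0        = inj₂ (inj₂ (subst (Exhausted (N h)) (sym (⊖≡0⇒≡ w⊖h≡0)) root-exhausted))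
    ... | inj₂ (inj₁ close) = inj₁ (∈-N-root .from close)
    ... | inj₂ (inj₂ far)   = inj₂ (inj₁ (∈-far-side .from far))

    Adj-via-offset : ∀ {w b} → b < n → Close ∣ w ⊖ h - b ∣ → Adj w (h ⊕ b)
    Adj-via-offset {w} b<n close = subst (λ z → Adj z (h ⊕ _)) (⊕-⊖ h w) (Adj-⊕⇔~ h (⊖<n w h) b<n .from close)

    root-branching : ∀ {w} → w ∈ N h → TwoNeighbours (_∉ N h) w
    root-branching {w} w∈Nh with near-has-far-neighbour 1≤t (⊖<n w h) (∈-N-root .to w∈Nh)
    ... | b , b-far , close =
      h , h ⊕ b , h≢h⊕b , ∉C⇒∉N-self h∉C , far-side-avoids (⊕-∈-far-side b-far) ,
      Adj-sym (Adj⇔Close-⊖ h w .from (∈-N-root .to w∈Nh)) , Adj-via-offset (far-offset<n b-far) close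
      where
      h≢h⊕b : h ≢ h ⊕ b
      h≢h⊕b h≡h⊕b = case ⊕-injective h 0<n (far-offset<n b-far) (trans (⊕-zero h) h≡h⊕b) of λ
        { refl → case proj₁ b-far of λ () }

    far-offset-⊖ : ∀ {u} → u ∈ₗ far-side → FarOffset (u ⊖ h)
    far-offset-⊖ = ∈-far-side .to

    Adj-far⇔ : PathCase → ∀ {a b} → FarOffset a → FarOffset b → Adj (h ⊕ a) (h ⊕ b) ⇔ ∣ a - b ∣ ≡ 1
    Adj-far⇔ path-case a-far b-far =
      Close⇔≡1 1≤k path-case (far-distance<t a-far b-far) ⇔-∘ Adj-⊕⇔~ h (far-offset<n a-far) (far-offset<n b-far)

    far-side-lookup : PathCase → ∀ i j →
                      adj n k (lookup far-side i) (lookup far-side j) ≡ true ⇔ (∣ toℕ i - toℕ j ∣ ≡ 1)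
    far-side-lookup path-case i j =
      mk⇔ (subst (_≡ 1) (∣m+n-m+o∣≡∣n-o∣ (suc k) (toℕ i) (toℕ j)))
          (subst (_≡ 1) (sym (∣m+n-m+o∣≡∣n-o∣ (suc k) (toℕ i) (toℕ j))))
      ⇔-∘ (Adj-far⇔ path-case (far i) (far j)
      ⇔-∘ mk⇔ (subst₂ Adj (proj₁ (at i)) (proj₁ (at j)) ∘ adjacent)
              (adj≡true ∘ subst₂ Adj (sym (proj₁ (at i))) (sym (proj₁ (at j)))))
      where
      at = lookup-map-range (h ⊕_) (suc k) t
      far : ∀ i → FarOffset (suc k + toℕ i)
      far i = m≤m+n (suc k) (toℕ i) , +-monoʳ-< (suc k) (proj₂ (at i))

    far-side-path : PathCase → InducedPath far-side
    far-side-path path-case = InducedPath-lookup far-side (far-side-lookup path-case)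

    Adj-far-⊖ : PathCase → ∀ {u b} → u ∈ₗ far-side → b ∈ₗ far-side → Adj u b → ∣ u ⊖ h - b ⊖ h ∣ ≡ 1
    Adj-far-⊖ path-case u∈ b∈ u~b =
      Close⇔≡1 1≤k path-case (far-distance<t (far-offset-⊖ u∈) (far-offset-⊖ b∈)) .to (Adj⇔~-⊖ h _ _ .to u~b)

    inner-far-offset : PathCase → ∀ {u} → u ∈ₗ far-side → Inner far-side u → suc k < u ⊖ h × suc (u ⊖ h) < suc k + t
    inner-far-offset path-case {u} u∈ (b , c , b≢c , b∈ , c∈ , u~b , u~c) =
      sides (∣m-n∣≡1⇒ _ _ (Adj-far-⊖ path-case u∈ b∈ u~b)) (∣m-n∣≡1⇒ _ _ (Adj-far-⊖ path-case u∈ c∈ u~c))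
      where
      A = u ⊖ h
      B≢C : b ⊖ h ≢ c ⊖ h
      B≢C B≡C = b≢c (trans (sym (⊕-⊖ h b)) (trans (cong (h ⊕_) B≡C) (⊕-⊖ h c)))
      between : ∀ {b c} → b ∈ₗ far-side → c ∈ₗ far-side → b ⊖ h ≡ suc A → A ≡ suc (c ⊖ h) →
                suc k < A × suc A < suc k + t
      between b∈ c∈ B≡1+A A≡1+C =
        subst (suc k <_) (sym A≡1+C) (s≤s (proj₁ (far-offset-⊖ c∈))) ,
        subst (_< suc k + t) B≡1+A (proj₂ (far-offset-⊖ b∈))
      sides : b ⊖ h ≡ suc A ⊎ A ≡ suc (b ⊖ h) → c ⊖ h ≡ suc A ⊎ A ≡ suc (c ⊖ h) → suc k < A × suc A < suc k + t
      sides (inj₁ B≡1+A) (inj₁ C≡1+A) = ⊥-elim (B≢C (trans B≡1+A (sym C≡1+A)))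
      sides (inj₂ A≡1+B) (inj₂ A≡1+C) = ⊥-elim (B≢C (suc-injective (trans (sym A≡1+B) A≡1+C)))
      sides (inj₁ B≡1+A) (inj₂ A≡1+C) = between b∈ c∈ B≡1+A A≡1+C
      sides (inj₂ A≡1+B) (inj₁ C≡1+A) = between c∈ b∈ C≡1+A A≡1+B

    root-reaches-ends : PathCase → ∀ {w u} → w ∈ N h → u ∈ₗ far-side → Adj w u → ¬ Inner far-side u
    root-reaches-ends path-case {w} {u} w∈Nh u∈ w~u inner
      with far-offset-end path-case (far-offset-⊖ u∈)
             (near-far-Close (⊖<n w h) (∈-N-root .to w∈Nh) (far-offset-⊖ u∈) (Adj⇔~-⊖ h w u .to w~u))
    ... | inj₁ A≡1+k = <-irrefl (sym A≡1+k) (proj₁ (inner-far-offset path-case u∈ inner))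
    ... | inj₂ A≡k+t = <-irrefl (cong suc A≡k+t) (proj₂ (inner-far-offset path-case u∈ inner))

    root-residue : PathCase → Residue (N h) far-side
    root-residue path-case = record
      { classify = classify-root ; unique = far-side-unique ; path = far-side-path path-case
      ; avoids = far-side-avoids ; branching = root-branching ; reaches-ends = root-reaches-ends path-case }

    ∈-far-side⇔∉Nclosed : ∀ w → w ∈ₗ far-side ⇔ w ∉ Nclosed n k h
    ∈-far-side⇔∉Nclosed w = mk⇔ to′ from′
      where
      to′ : w ∈ₗ far-side → w ∉ Nclosed n k h
      to′ w∈ w∈N[h] with ∈-Nclosed⁻ h w∈N[h]
      ... | inj₁ refl = case subst (suc k ≤_) (⊖-self h) (proj₁ (far-offset-⊖ w∈)) of λ ()
      ... | inj₂ h~w  = far-offset-¬Close (far-offset-⊖ w∈) (Adj⇔Close-⊖ h w .to h~w)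
      from′ : w ∉ Nclosed n k h → w ∈ₗ far-side
      from′ w∉N[h] with offset-trichotomy (⊖<n w h)
      ... | inj₁ w⊖h≡0        = ⊥-elim (w∉N[h] (subst (_∈ Nclosed n k h) (sym (⊖≡0⇒≡ w⊖h≡0)) (∈-Nclosed-self h)))
      ... | inj₂ (inj₁ close) = ⊥-elim (w∉N[h] (∈-Nclosed-adj (Adj⇔Close-⊖ h w .from close)))
      ... | inj₂ (inj₂ far)   = ∈-far-side .from far

    Tight-root : ∀ {rs} → length rs ≡ suc t → Tight (N h) rs
    Tight-root {rs} |rs|≡1+t = ≤-reflexive (sym (begin
      length rs + ∣ N h ∣  ≡⟨ cong₂ _+_ |rs|≡1+t (∣N∣-∉C h∉C) ⟩
      suc t + (k + k)      ≡⟨ cong suc (+-comm t (k + k)) ⟩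
      n                    ∎))
      where open ≡-Reasoning

    tail⇒CaseII : PathCase → ∀ rs → LegalFrom n k C (N h) rs → length rs ≡ suc t → CaseII n k C
    tail⇒CaseII path-case rs legal |rs|≡1+t =
      h , h∉C , far-side , trans length-far-side (sym n∸[2k+1]≡t) ,
      (far-side-unique , ∈-far-side⇔∉Nclosed , far-side-lookup path-case) ,
      Residue⇒Gconf rs (root-residue path-case) far-side≢[] legal (Tight-root {rs} |rs|≡1+t)
      where
      far-side≢[] : far-side ≢ []
      far-side≢[] far-side≡[] = <⇒≢ 1≤t (sym (trans (sym length-far-side) (cong length far-side≡[])))

    far-side-branching : 2 ≤ k → 3 ≤ t → ∀ {u} → u ∈ₗ far-side → TwoNeighbours (_∈ₗ far-side) u
    far-side-branching 2≤k 3≤t u∈ with two-far-offsets 3≤t (far-offset-⊖ u∈)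
    ... | b , c , b≢c , b-far , c-far , (1≤∣u-b∣ , ∣u-b∣≤2) , (1≤∣u-c∣ , ∣u-c∣≤2) =
      h ⊕ b , h ⊕ c , b≢c ∘ ⊕-injective h (far-offset<n b-far) (far-offset<n c-far) ,
      ⊕-∈-far-side b-far , ⊕-∈-far-side c-far ,
      Adj-via-offset (far-offset<n b-far) (1≤∣u-b∣ , inj₁ (≤-trans ∣u-b∣≤2 2≤k)) ,
      Adj-via-offset (far-offset<n c-far) (1≤∣u-c∣ , inj₁ (≤-trans ∣u-c∣≤2 2≤k))

    no-tail : 2 ≤ k → 3 ≤ t → ∀ rs → LegalFrom n k C (N h) rs → length rs ≢ suc t
    no-tail 2≤k 3≤t (v ∷ rs) legal |rs|≡1+t =
      Tight-¬TwoNeighbours legal tight (TwoNeighbours-map (λ _ → far-side-avoids) (far-side-branching 2≤k 3≤t v∈))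
      where
      tight = Tight-root {v ∷ rs} |rs|≡1+t
      v∈ = Tight-first∈ {v = v} {rs} classify-root root-branching legal tight

module Classification (k t : ℕ) (1≤k : 1 ≤ k) (1≤t : 1 ≤ t) (C : Subset (suc (k + k + t))) where

  open Web k t C
  open FarSide k t C
  open TightSequences n k C

  LegalDominatingOfLength : ℕ → Set
  LegalDominatingOfLength m = ∃[ vs ] (Legal n k C vs × Dominating n k C vs × length vs ≡ m)

  arc-sequence : LegalDominatingOfLength (suc t)
  arc-sequence = arc 1≤k 1≤t Fin.zero , arc-legal 1≤k 1≤t Fin.zero , arc-dominating 1≤k 1≤t Fin.zero ,
                    length-arc 1≤k 1≤t Fin.zero

  CaseII⇒long-sequence : CaseII n k C → LegalDominatingOfLength (suc (suc t))
  CaseII⇒long-sequence (i , i∉C , us , |us|≡ , induced , gconf) =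
    let vs , legal , dominating , |vs|≡ = Gconf⇒LegalDominating i∉C (Adj-⊕1 1≤k i) induced gconf
    in vs , legal , dominating , trans |vs|≡ (cong (2 +_) (trans |us|≡ n∸[2k+1]≡t))

  IsGammaGr-intro : ∀ {m m′} → LegalDominatingOfLength m → m ≡ m′ → (∀ vs → Legal n k C vs → length vs ≤ m′) →
                    IsGammaGr n k C m′
  IsGammaGr-intro (vs , legal , dominating , |vs|≡m) m≡m′ bound =
    (vs , legal , dominating , trans |vs|≡m m≡m′) , λ vs legal _ → bound vs legal

  no-tail-unless-CaseII : ¬ CaseII n k C → ∀ {h} → h ∉ C → ∀ rs → LegalFrom n k C (N h) rs → length rs ≢ suc t
  no-tail-unless-CaseII ¬II {h} h∉C rs legal |rs|≡1+t with k ≟ 1 | t ≤? 2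
  ... | yes k≡1 | _      = ¬II (tail⇒CaseII 1≤k 1≤t h h∉C (inj₁ k≡1) rs legal |rs|≡1+t)
  ... | no _    | yes t≤2 = ¬II (tail⇒CaseII 1≤k 1≤t h h∉C (inj₂ t≤2) rs legal |rs|≡1+t)
  ... | no k≢1  | no t≰2  = no-tail 1≤k 1≤t h h∉C (≤∧≢⇒< 1≤k (k≢1 ∘ sym)) (≰⇒> t≰2) rs legal |rs|≡1+t

  short-unless-CaseII : ¬ CaseII n k C → ∀ vs → Legal n k C vs → length vs ≤ suc t
  short-unless-CaseII ¬II []       _          = z≤n
  short-unless-CaseII ¬II (h ∷ rs) (_ , legal) = s≤s (case h ∈? C of λ
    { (yes h∈C) → subst (length rs ≤_) (m+n∸m≡n (k + k) t) (bound (∣N∣-∈C h∈C))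
    ; (no h∉C)  → s≤s⁻¹ (≤∧≢⇒< (subst (length rs ≤_) n∸2k≡1+t (bound (∣N∣-∉C h∉C)))
                                 (no-tail-unless-CaseII ¬II h∉C rs legal)) })
    where
    bound : ∀ {m} → ∣ N h ∣ ≡ m → length rs ≤ n ∸ m
    bound ∣N∣≡m = m+n≤o⇒m≤o∸n (length rs) (subst (λ m → length rs + m ≤ n) ∣N∣≡m (LegalFrom-length (N h) rs legal))
    n∸2k≡1+t : n ∸ (k + k) ≡ suc t
    n∸2k≡1+t = trans (+-∸-assoc 1 (m≤m+n (k + k) t)) (cong suc (m+n∸m≡n (k + k) t))

  classification : (CaseI n C ⊎ CaseII n k C → IsGammaGr n k C (m₁ n k C)) ×
                   (¬ (CaseI n C ⊎ CaseII n k C) → IsGammaGr n k C (m₁ n k C ∸ 1))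
  classification with all? (_∈? C)
  ... | yes all∈C =
    (λ _ → IsGammaGr-intro arc-sequence (sym (m₁≡-CaseI all∈C)) Legal-length≤m₁) ,
    (λ ¬I⊎II → ⊥-elim (¬I⊎II (inj₁ all∈C)))
  ... | no ¬all∈C =
    [ (λ all∈C → ⊥-elim (v₀∉C (all∈C v₀))) ,
      (λ II → IsGammaGr-intro (CaseII⇒long-sequence II) (sym (m₁≡-∉C v₀∉C)) Legal-length≤m₁) ]′ ,
    (λ ¬I⊎II → IsGammaGr-intro arc-sequence (sym m₁∸1≡1+t)
                 (λ vs legal → subst (length vs ≤_) (sym m₁∸1≡1+t) (short-unless-CaseII (¬I⊎II ∘ inj₂) vs legal)))
    where
    v₀ = proj₁ (¬∀⟶∃¬ n _ (_∈? C) ¬all∈C)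
    v₀∉C = proj₂ (¬∀⟶∃¬ n _ (_∈? C) ¬all∈C)
    m₁∸1≡1+t : m₁ n k C ∸ 1 ≡ suc t
    m₁∸1≡1+t = cong (_∸ 1) (m₁≡-∉C v₀∉C)

web-normal-form : ∀ k d → suc (k + k + suc d) ≡ 2 * (k + 1) + d
web-normal-form = solve-∀

proposition4 : (n k : ℕ) → 1 ≤ k → 2 * (k + 1) ≤ n → (C : Subset n) →
    ((CaseI n C ⊎ CaseII n k C) → IsGammaGr n k C (m₁ n k C)) ×
    (¬ (CaseI n C ⊎ CaseII n k C) → IsGammaGr n k C (m₁ n k C ∸ 1))
proposition4 n k 1≤k 2[k+1]≤n =
  subst Classified (trans (web-normal-form k d) (m+[n∸m]≡n 2[k+1]≤n))
    (Classification.classification k (suc d) 1≤k (s≤s z≤n))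
  where
  d = n ∸ 2 * (k + 1)
  Classified : ℕ → Set
  Classified n = (C : Subset n) →
    ((CaseI n C ⊎ CaseII n k C) → IsGammaGr n k C (m₁ n k C)) ×
    (¬ (CaseI n C ⊎ CaseII n k C) → IsGammaGr n k C (m₁ n k C ∸ 1))
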